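{- For positive integers $n,k,t$ with $k,t\le n$, \[\left[{n\atop k/t}\right]=\sum_{j=t}^{n-k+1}(k-1)!\binom{n}{j}\left[{j\atop t}\right]\left[{n-j\atop k-1}\right].\]
   Context: $\left[{n\atop m}\right]$ is the signless Stirling number of the first kind (number of permutations of $[n]$ with exactly $m$ cycles, $\left[{0\atop 0}\right]=1$). For integers $n\ge0$, $k\ge1$, $t\ge0$, a mixed coloured permutation of $[n]$ is a permutation of $[n]$ together with a colouring of its cycles with colours from $\{1,\ldots,k\}$ such that exactly $t$ cycles receive colour $1$ (the special colour) and each of the colours $2,\ldots,k$ is used on exactly one cycle; $\left[{n\atop k/t}\right]$ denotes their number. -}

module Defs where

open import Data.Nat using (ℕ; zero; suc; _+_; _*_; _∸_)
open import Data.Fin using (Fin; zero; suc; toℕ; _≤_)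
import Data.Fin.Properties as FinP
open import Data.Vec using (Vec; []; _∷_; lookup)
open import Data.List using (List; []; _∷_; length; filter; allFin; concatMap; map)
open import Data.Product using (_×_; _,_; proj₁; proj₂)
open import Relation.Binary.PropositionalEquality using (_≡_)
open import Relation.Nullary using (Dec; _×-dec_; ¬?)
open import Relation.Nullary.Decidable using (_→-dec_)
import Data.Nat.Properties as NatP

allVecs : ∀ {a} {A : Set a} → List A → (n : ℕ) → List (Vec A n)
allVecs xs zero    = [] ∷ []
allVecs xs (suc n) = concatMap (λ x → map (x ∷_) (allVecs xs n)) xs

-- A map σ : [n] → [n] (given as the vector of its values).
-- It is a permutation iff it is injective (equivalently bijective, [n] finite).
IsPerm : ∀ {n} → Vec (Fin n) n → Set
IsPerm {n} σ = ∀ (i j : Fin n) → lookup σ i ≡ lookup σ j → i ≡ j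

isPerm? : ∀ {n} (σ : Vec (Fin n) n) → Dec (IsPerm σ)
isPerm? σ = FinP.all? λ i → FinP.all? λ j →
  (lookup σ i FinP.≟ lookup σ j) →-dec (i FinP.≟ j)

iter : ∀ {n} → Vec (Fin n) n → ℕ → Fin n → Fin n
iter σ zero    i = i
iter σ (suc m) i = lookup σ (iter σ m i)

IsCycleMin : ∀ {n} → Vec (Fin n) n → Fin n → Set
IsCycleMin {n} σ i = ∀ (m : Fin n) → i ≤ iter σ (toℕ m) i

isCycleMin? : ∀ {n} (σ : Vec (Fin n) n) (i : Fin n) → Dec (IsCycleMin σ i)
isCycleMin? σ i = FinP.all? λ m → i FinP.≤? iter σ (toℕ m) i

-- number of cycles of σ  (= number of cycle minima)
cycles : ∀ {n} → Vec (Fin n) n → ℕ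
cycles {n} σ = length (filter (isCycleMin? σ) (allFin n))

stirling1 : ℕ → ℕ → ℕ
stirling1 n m = length (filter P? (allVecs (allFin n) n))
  where
  P? : (σ : Vec (Fin n) n) → Dec (IsPerm σ × cycles σ ≡ m)
  P? σ = isPerm? σ ×-dec (cycles σ NatP.≟ m)

-- A colouring of the cycles of σ with colours Fin k is recorded as a
-- map col : [n] → Fin k that is constant on cycles (col (σ i) = col i);
-- the colour of a cycle is the common colour of its elements.
-- Colour `zero` plays the role of the special colour 1; colours
-- `suc c` are the colours 2,…,k.
IsCycleColouring : ∀ {n k} → Vec (Fin n) n → Vec (Fin k) n → Set
IsCycleColouring {n} σ col = ∀ (i : Fin n) → lookup col (lookup σ i) ≡ lookup col i

isCycleColouring? : ∀ {n k} (σ : Vec (Fin n) n) (col : Vec (Fin k) n) →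
                    Dec (IsCycleColouring σ col)
isCycleColouring? σ col = FinP.all? λ i → lookup col (lookup σ i) FinP.≟ lookup col i

cyclesOfColour : ∀ {n k} → Vec (Fin n) n → Vec (Fin k) n → Fin k → ℕ
cyclesOfColour {n} σ col c =
  length (filter (λ i → isCycleMin? σ i ×-dec (lookup col i FinP.≟ c)) (allFin n))

IsMixed : ∀ {n k} → ℕ → Vec (Fin n) n → Vec (Fin (suc k)) n → Set
IsMixed {n} {k} t σ col =
  IsPerm σ × IsCycleColouring σ col ×
  (cyclesOfColour σ col zero ≡ t) ×
  (∀ (c : Fin k) → cyclesOfColour σ col (suc c) ≡ 1)

isMixed? : ∀ {n k} (t : ℕ) (σ : Vec (Fin n) n) (col : Vec (Fin (suc k)) n) →
           Dec (IsMixed t σ col)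
isMixed? t σ col =
  isPerm? σ ×-dec isCycleColouring? σ col ×-dec
  (cyclesOfColour σ col zero NatP.≟ t) ×-dec
  FinP.all? (λ c → cyclesOfColour σ col (suc c) NatP.≟ 1)

-- For k = 0 (not used) we set the value to 0.
mixedStirling : ℕ → ℕ → ℕ → ℕ
mixedStirling n zero    t = 0
mixedStirling n (suc k) t =
  length (filter (λ p → isMixed? t (proj₁ p) (proj₂ p))
                 (concatMap (λ σ → map (σ ,_) (allVecs (allFin (suc k)) n))
                            (allVecs (allFin n) n)))

-- Σ_{j=a}^{b} f j  (empty, i.e. 0, when b < a)
sumFromTo : ℕ → ℕ → (ℕ → ℕ) → ℕ
sumFromTo a b f = go a (suc b ∸ a)
  where
  go : ℕ → ℕ → ℕ
  go j zero    = 0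
  go j (suc r) = f j + go (suc j) r

module Submission where

open import Defs
open import Data.Nat using (ℕ; _+_; _*_; _∸_; _≤_; _<_; _!)
open import Data.Nat.Combinatorics using (_C_)
open import Relation.Binary.PropositionalEquality using (_≡_)

open import Data.Nat using (zero; suc; _≤?_; _≟_; s≤s; s≤s⁻¹; z≤n)
open import Data.Nat.Properties
open import Data.Nat.DivMod using (_%_; _/_; m≡m%n+[m/n]*n; m%n<n)
open import Data.Nat.Combinatorics using (nCk+nC[k+1]≡[n+1]C[k+1]; k>n⇒nCk≡0)
open import Data.Nat.Tactic.RingSolver using (solve-∀)
open import Algebra.Properties.CommutativeSemigroup +-commutativeSemigroup
  using () renaming (x∙yz≈y∙xz to x+[y+z]≡y+[x+z])
open import Algebra.Properties.CommutativeSemigroup *-commutativeSemigroup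
  using () renaming (x∙yz≈y∙xz to x*[y*z]≡y*[x*z])
open import Data.Fin as F using (Fin; zero; suc; toℕ; fromℕ; inject₁; fromℕ<)
import Data.Fin.Properties as FP
open import Data.Fin.Relation.Unary.Top using (view; ‵fromℕ; ‵inj₁; view-fromℕ; view-inject₁)
open import Data.Vec using (Vec; []; _∷_; lookup; tabulate; replicate)
open import Data.Vec.Properties using (lookup∘tabulate; tabulate∘lookup; tabulate-cong)
import Data.Vec.Properties as VecP
open import Data.List using (List; []; _∷_; length; filter; allFin; concatMap; map; _++_)
open import Data.Product using (_×_; _,_; proj₁; proj₂; ∃; ∃-syntax)
import Data.Product.Properties as ProdP
open import Data.Sum using (_⊎_; inj₁; inj₂)
open import Data.Empty using (⊥-elim)
open import Function using (id; _∘_)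
open import Relation.Binary using (DecidableEquality)
open import Relation.Binary.PropositionalEquality
open import Relation.Nullary using (Dec; yes; no; ¬_; _×-dec_; ¬?)

-- Mixed coloured permutations are coloured permutations (a permutation of
-- Fin n with a colouring of its cycles) of a prescribed profile
-- a : Fin K → ℕ, namely t cycles of colour 0 and one of every other colour.
-- 1. Counting toolkit: counts as sums of 0/1 indicators over enumeration
--    lists, and bijective counting between two enumerations.
-- 2. The top point L: deleting it from a permutation, and the two inverse
--    insertions (as a new 1-cycle, or right after some old point p).
-- 3. Hence N = colouredPerms obeys N(n+1, a) = Σ_c [a_c ≥ 1] N(n, a - e_c) + n·N(n, a),
--    and so Π_c a_c! · N(n, a) = (Σ a)! · s(n, Σ a), s the recursive Stirling numbers.
-- 4. The binomial convolution Σ_j C(n,j) s(j,t) s(n-j,r) satisfies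
--    t! r! Σ_j … = (t+r)! s(n, t+r) (both sides obey the same recurrence).
-- 5. One colour gives [n m] = s(n, m); the mixed profile then gives
--    [n, (k+1)/t] = k! Σ_{j=0}^{n} C(n,j) s(j,t) s(n-j,k), and the terms
--    outside t ≤ j ≤ n-k vanish.

-- Indicator (0/1) of a decided proposition; counting a filtered list is
-- summing indicators, which lets us count by algebra.
ind : ∀ {p} {P : Set p} → Dec P → ℕ
ind (yes _) = 1
ind (no _)  = 0

ind-cong : ∀ {p q} {P : Set p} {Q : Set q} (d : Dec P) (e : Dec Q) →
           (P → Q) → (Q → P) → ind d ≡ ind e
ind-cong (yes _) (yes _)  _ _ = refl
ind-cong (yes p) (no ¬q)  f _ = ⊥-elim (¬q (f p))
ind-cong (no ¬p) (yes q)  _ g = ⊥-elim (¬p (g q))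
ind-cong (no _)  (no _)   _ _ = refl

ind-× : ∀ {p q} {P : Set p} {Q : Set q} (d : Dec P) (e : Dec Q) →
        ind (d ×-dec e) ≡ ind d * ind e
ind-× (yes _) (yes _) = refl
ind-× (yes _) (no _)  = refl
ind-× (no _)  _       = refl

ind-yes : ∀ {p} {P : Set p} (d : Dec P) → P → ind d ≡ 1
ind-yes (yes _) _ = refl
ind-yes (no ¬p) p = ⊥-elim (¬p p)

ind-no : ∀ {p} {P : Set p} (d : Dec P) → ¬ P → ind d ≡ 0
ind-no (yes p) ¬p = ⊥-elim (¬p p)
ind-no (no _)  _  = refl

ind-split : ∀ {p q} {P : Set p} {Q : Set q} (d : Dec P) (e : Dec Q) →
            ind d ≡ ind (d ×-dec e) + ind (d ×-dec ¬? e)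
ind-split (yes _) (yes _) = refl
ind-split (yes _) (no _)  = refl
ind-split (no _)  _       = refl

sumL : ∀ {a} {A : Set a} → List A → (A → ℕ) → ℕ
sumL []       f = 0
sumL (x ∷ xs) f = f x + sumL xs f

length-filter : ∀ {a p} {A : Set a} {P : A → Set p} (P? : ∀ x → Dec (P x)) (xs : List A) →
                length (filter P? xs) ≡ sumL xs (λ x → ind (P? x))
length-filter P? []       = refl
length-filter P? (x ∷ xs) with P? x
... | yes _ = cong suc (length-filter P? xs)
... | no _  = length-filter P? xs

sumL-cong : ∀ {a} {A : Set a} (xs : List A) {f g : A → ℕ} →
            (∀ x → f x ≡ g x) → sumL xs f ≡ sumL xs g
sumL-cong []       e = refl
sumL-cong (x ∷ xs) e = cong₂ _+_ (e x) (sumL-cong xs e)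

sumL-0 : ∀ {a} {A : Set a} (xs : List A) → sumL xs (λ _ → 0) ≡ 0
sumL-0 []       = refl
sumL-0 (x ∷ xs) = sumL-0 xs

sumL-+ : ∀ {a} {A : Set a} (xs : List A) (f g : A → ℕ) →
         sumL xs (λ x → f x + g x) ≡ sumL xs f + sumL xs g
sumL-+ []       f g = refl
sumL-+ (x ∷ xs) f g = begin
  f x + g x + sumL xs (λ x → f x + g x) ≡⟨ cong (f x + g x +_) (sumL-+ xs f g) ⟩
  f x + g x + (sumL xs f + sumL xs g)   ≡⟨ +-assoc (f x) (g x) _ ⟩
  f x + (g x + (sumL xs f + sumL xs g)) ≡⟨ cong (f x +_) (x+[y+z]≡y+[x+z] (g x) (sumL xs f) _) ⟩
  f x + (sumL xs f + (g x + sumL xs g)) ≡⟨ +-assoc (f x) _ _ ⟨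
  f x + sumL xs f + (g x + sumL xs g)   ∎
  where open ≡-Reasoning

sumL-*ˡ : ∀ {a} {A : Set a} (xs : List A) (k : ℕ) (f : A → ℕ) →
          sumL xs (λ x → k * f x) ≡ k * sumL xs f
sumL-*ˡ []       k f = sym (*-zeroʳ k)
sumL-*ˡ (x ∷ xs) k f = trans (cong (k * f x +_) (sumL-*ˡ xs k f)) (sym (*-distribˡ-+ k (f x) _))

sumL-swap : ∀ {a b} {A : Set a} {B : Set b} (xs : List A) (ys : List B) (f : A → B → ℕ) →
            sumL xs (λ x → sumL ys (f x)) ≡ sumL ys (λ y → sumL xs (λ x → f x y))
sumL-swap []       ys f = sym (sumL-0 ys)
sumL-swap (x ∷ xs) ys f =
  trans (cong (sumL ys (f x) +_) (sumL-swap xs ys f)) (sym (sumL-+ ys (f x) _))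

sumL-++ : ∀ {a} {A : Set a} (xs ys : List A) (f : A → ℕ) →
          sumL (xs ++ ys) f ≡ sumL xs f + sumL ys f
sumL-++ []       ys f = refl
sumL-++ (x ∷ xs) ys f = trans (cong (f x +_) (sumL-++ xs ys f)) (sym (+-assoc (f x) _ _))

sumL-map : ∀ {a b} {A : Set a} {B : Set b} (h : A → B) (xs : List A) (f : B → ℕ) →
           sumL (map h xs) f ≡ sumL xs (λ x → f (h x))
sumL-map h []       f = refl
sumL-map h (x ∷ xs) f = cong (f (h x) +_) (sumL-map h xs f)

sumL-concatMap : ∀ {a b} {A : Set a} {B : Set b} (h : A → List B) (xs : List A) (f : B → ℕ) →
                 sumL (concatMap h xs) f ≡ sumL xs (λ x → sumL (h x) f)
sumL-concatMap h []       f = refl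
sumL-concatMap h (x ∷ xs) f =
  trans (sumL-++ (h x) (concatMap h xs) f) (cong (sumL (h x) f +_) (sumL-concatMap h xs f))

sumF : (K : ℕ) → (Fin K → ℕ) → ℕ
sumF zero    f = 0
sumF (suc K) f = f zero + sumF K (λ i → f (suc i))

sumF-cong : ∀ K {f g : Fin K → ℕ} → (∀ i → f i ≡ g i) → sumF K f ≡ sumF K g
sumF-cong zero    e = refl
sumF-cong (suc K) e = cong₂ _+_ (e zero) (sumF-cong K (λ i → e (suc i)))

sumL-allFin : ∀ K (f : Fin K → ℕ) → sumL (allFin K) f ≡ sumF K f
sumL-allFin K f = go K (λ i → i)
  where
  go : ∀ K (h : Fin K → Fin _) → sumL (Data.List.tabulate h) f ≡ sumF K (λ i → f (h i))
  go zero    h = refl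
  go (suc K) h = cong (f (h zero) +_) (go K (λ i → h (suc i)))

sumF-const : ∀ K x → sumF K (λ _ → x) ≡ K * x
sumF-const zero    x = refl
sumF-const (suc K) x = cong (x +_) (sumF-const K x)

sumF-*ˡ : ∀ K (f : Fin K → ℕ) x → sumF K (λ i → x * f i) ≡ x * sumF K f
sumF-*ˡ zero    f x = sym (*-zeroʳ x)
sumF-*ˡ (suc K) f x =
  trans (cong (x * f zero +_) (sumF-*ˡ K (λ i → f (suc i)) x)) (sym (*-distribˡ-+ x (f zero) _))

sumF-*ʳ : ∀ K (f : Fin K → ℕ) x → sumF K (λ i → f i * x) ≡ sumF K f * x
sumF-*ʳ K f x = trans (sumF-cong K (λ i → *-comm (f i) x))
                      (trans (sumF-*ˡ K f x) (*-comm x (sumF K f)))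

sumF-last : ∀ K (f : Fin (suc K) → ℕ) → sumF (suc K) f ≡ sumF K (λ i → f (inject₁ i)) + f (fromℕ K)
sumF-last zero    f = +-comm (f zero) 0
sumF-last (suc K) f =
  trans (cong (f zero +_) (sumF-last K (λ i → f (suc i)))) (sym (+-assoc (f zero) _ _))

ExactlyOnce : ∀ {a} {A : Set a} → DecidableEquality A → List A → Set a
ExactlyOnce {A = A} _≟_ xs = ∀ (a : A) → sumL xs (λ x → ind (x ≟ a)) ≡ 1

sumL-once : ∀ {c} {C : Set c} {_≟_ : DecidableEquality C} (zs : List C) → ExactlyOnce _≟_ zs →
            ∀ k z → sumL zs (λ w → k * ind (w ≟ z)) ≡ k
sumL-once zs once k z = trans (sumL-*ˡ zs k _) (trans (cong (k *_) (once z)) (*-identityʳ k))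

bij-count : ∀ {a b p q} {A : Set a} {B : Set b} (_≟A_ : DecidableEquality A) (_≟B_ : DecidableEquality B)
  (xs : List A) (ys : List B) → ExactlyOnce _≟A_ xs → ExactlyOnce _≟B_ ys →
  {P : A → Set p} {Q : B → Set q} (P? : ∀ x → Dec (P x)) (Q? : ∀ y → Dec (Q y))
  (f : A → B) (g : B → A) →
  (∀ x → P x → Q (f x)) → (∀ y → Q y → P (g y)) →
  (∀ x → P x → g (f x) ≡ x) → (∀ y → Q y → f (g y) ≡ y) →
  sumL xs (λ x → ind (P? x)) ≡ sumL ys (λ y → ind (Q? y))
bij-count _≟A_ _≟B_ xs ys onceA onceB P? Q? f g PQ QP gf fg = begin
  sumL xs (λ x → ind (P? x))
    ≡⟨ sumL-cong xs (λ x → sym (sumL-once ys onceB (ind (P? x)) (f x))) ⟩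
  sumL xs (λ x → sumL ys (λ y → ind (P? x) * ind (y ≟B f x)))
    ≡⟨ sumL-swap xs ys _ ⟩
  sumL ys (λ y → sumL xs (λ x → ind (P? x) * ind (y ≟B f x)))
    ≡⟨ sumL-cong ys (λ y → sumL-cong xs (λ x → graph x y)) ⟩
  sumL ys (λ y → sumL xs (λ x → ind (Q? y) * ind (x ≟A g y)))
    ≡⟨ sumL-cong ys (λ y → sumL-once xs onceA (ind (Q? y)) (g y)) ⟩
  sumL ys (λ y → ind (Q? y)) ∎
  where
  open ≡-Reasoning
  -- both sides are the indicator of "P x and y = f x", i.e. of "Q y and x = g y"
  graph : ∀ x y → ind (P? x) * ind (y ≟B f x) ≡ ind (Q? y) * ind (x ≟A g y)
  graph x y with P? x | y ≟B f x | Q? y | x ≟A g y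
  ... | yes p | yes refl | yes _ | yes _  = refl
  ... | yes p | yes refl | yes _ | no ne  = ⊥-elim (ne (sym (gf x p)))
  ... | yes p | yes refl | no nq | _      = ⊥-elim (nq (PQ x p))
  ... | _     | no ne    | yes q | yes refl = ⊥-elim (ne (sym (fg y q)))
  ... | no np | _        | yes q | yes refl = ⊥-elim (np (QP y q))
  ... | yes _ | no _     | yes _ | no _   = refl
  ... | yes _ | no _     | no _  | _      = refl
  ... | no _  | _        | yes _ | no _   = refl
  ... | no _  | yes _    | no _  | _      = refl
  ... | no _  | no _     | no _  | _      = refl

EO-allFin : ∀ K → ExactlyOnce F._≟_ (allFin K)
EO-allFin K a = trans (sumL-allFin K _) (go K a)
  where
  go : ∀ K (a : Fin K) → sumF K (λ x → ind (x F.≟ a)) ≡ 1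
  go (suc K) zero    = cong suc (trans (sumF-cong K (λ i → ind-no (suc i F.≟ zero) (λ ())))
                                       (trans (sumF-const K 0) (*-zeroʳ K)))
  go (suc K) (suc a) = trans (cong₂ _+_ (ind-no (zero F.≟ suc a) (λ ()))
                               (sumF-cong K (λ i → ind-cong (suc i F.≟ suc a) (i F.≟ a) FP.suc-injective (cong suc))))
                             (go K a)

prodL : ∀ {a b} {A : Set a} {B : Set b} → List A → List B → List (A × B)
prodL xs ys = concatMap (λ x → map (x ,_) ys) xs

sumL-prod : ∀ {a b} {A : Set a} {B : Set b} (xs : List A) (ys : List B) (f : A × B → ℕ) →
            sumL (prodL xs ys) f ≡ sumL xs (λ x → sumL ys (λ y → f (x , y)))
sumL-prod xs ys f = trans (sumL-concatMap _ xs f) (sumL-cong xs (λ x → sumL-map (x ,_) ys f))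

EO-prod : ∀ {a b} {A : Set a} {B : Set b} (_≟A_ : DecidableEquality A) (_≟B_ : DecidableEquality B)
  (xs : List A) (ys : List B) → ExactlyOnce _≟A_ xs → ExactlyOnce _≟B_ ys →
  ExactlyOnce (ProdP.≡-dec _≟A_ _≟B_) (prodL xs ys)
EO-prod _≟A_ _≟B_ xs ys onceA onceB (a , b) = begin
  sumL (prodL xs ys) (λ p → ind (ProdP.≡-dec _≟A_ _≟B_ p (a , b)))  ≡⟨ sumL-prod xs ys _ ⟩
  sumL xs (λ x → sumL ys (λ y → ind (ProdP.≡-dec _≟A_ _≟B_ (x , y) (a , b))))
    ≡⟨ sumL-cong xs (λ x → sumL-cong ys (λ y → pair x y)) ⟩
  sumL xs (λ x → sumL ys (λ y → ind (x ≟A a) * ind (y ≟B b)))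
    ≡⟨ sumL-cong xs (λ x → sumL-once ys onceB (ind (x ≟A a)) b) ⟩
  sumL xs (λ x → ind (x ≟A a))  ≡⟨ onceA a ⟩
  1 ∎
  where
  open ≡-Reasoning
  pair : ∀ x y → ind (ProdP.≡-dec _≟A_ _≟B_ (x , y) (a , b)) ≡ ind (x ≟A a) * ind (y ≟B b)
  pair x y = trans (ind-cong _ (x ≟A a ×-dec y ≟B b) (λ e → cong proj₁ e , cong proj₂ e)
                                                   (λ { (refl , refl) → refl }))
                   (ind-× (x ≟A a) (y ≟B b))

sumL-allVecs : ∀ {a} {A : Set a} (xs : List A) (n : ℕ) (f : Vec A (suc n) → ℕ) →
               sumL (allVecs xs (suc n)) f ≡ sumL xs (λ x → sumL (allVecs xs n) (λ v → f (x ∷ v)))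
sumL-allVecs xs n f = trans (sumL-concatMap _ xs f) (sumL-cong xs (λ x → sumL-map (x ∷_) (allVecs xs n) f))

EO-allVecs : ∀ {a} {A : Set a} (_≟_ : DecidableEquality A) (xs : List A) → ExactlyOnce _≟_ xs →
             ∀ n → ExactlyOnce (VecP.≡-dec _≟_) (allVecs xs n)
EO-allVecs _≟_ xs once zero    []       = refl
EO-allVecs _≟_ xs once (suc n) (a ∷ as) = begin
  sumL (allVecs xs (suc n)) (λ v → ind (VecP.≡-dec _≟_ v (a ∷ as)))  ≡⟨ sumL-allVecs xs n _ ⟩
  sumL xs (λ x → sumL (allVecs xs n) (λ v → ind (VecP.≡-dec _≟_ (x ∷ v) (a ∷ as))))
    ≡⟨ sumL-cong xs (λ x → sumL-cong (allVecs xs n) (λ v → cons x v)) ⟩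
  sumL xs (λ x → sumL (allVecs xs n) (λ v → ind (x ≟ a) * ind (VecP.≡-dec _≟_ v as)))
    ≡⟨ sumL-cong xs (λ x → sumL-once (allVecs xs n) (EO-allVecs _≟_ xs once n) (ind (x ≟ a)) as) ⟩
  sumL xs (λ x → ind (x ≟ a))  ≡⟨ once a ⟩
  1 ∎
  where
  open ≡-Reasoning
  cons : ∀ x v → ind (VecP.≡-dec _≟_ (x ∷ v) (a ∷ as)) ≡ ind (x ≟ a) * ind (VecP.≡-dec _≟_ v as)
  cons x v = trans (ind-cong _ (x ≟ a ×-dec VecP.≡-dec _≟_ v as)
                             (λ e → VecP.∷-injectiveˡ e , VecP.∷-injectiveʳ e) (λ { (refl , refl) → refl }))
                   (ind-× (x ≟ a) _)

caseTop : ∀ {n a} {A : Set a} → A → (Fin n → A) → Fin (suc n) → A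
caseTop top old i with view i
... | ‵fromℕ          = top
... | ‵inj₁ {i = j} _ = old j

caseTop-top : ∀ {n a} {A : Set a} (top : A) (old : Fin n → A) → caseTop top old (fromℕ n) ≡ top
caseTop-top {n} top old rewrite view-fromℕ n = refl

caseTop-old : ∀ {n a} {A : Set a} (top : A) (old : Fin n → A) j → caseTop top old (inject₁ j) ≡ old j
caseTop-old top old j rewrite view-inject₁ j = refl

-- Lowering a point of Fin (suc n) to Fin n (the top point goes to a default d).
lower : ∀ {n} → Fin n → Fin (suc n) → Fin n
lower d = caseTop d id

lower-inject : ∀ {n} (d : Fin n) y → y ≢ fromℕ n → inject₁ (lower d y) ≡ y
lower-inject d y y≢top with view y
... | ‵fromℕ  = ⊥-elim (y≢top refl)
... | ‵inj₁ _ = refl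

≤-top : ∀ {n} (x : Fin (suc n)) → x F.≤ fromℕ n
≤-top {n} x = subst (toℕ x ≤_) (sym (FP.toℕ-fromℕ n)) (s≤s⁻¹ (FP.toℕ<n x))

top≤⇒top : ∀ {n} (x : Fin (suc n)) → fromℕ n F.≤ x → x ≡ fromℕ n
top≤⇒top x le = FP.toℕ-injective (≤-antisym (≤-top x) le)

inject₁-≤ : ∀ {n} {x y : Fin n} → x F.≤ y → inject₁ x F.≤ inject₁ y
inject₁-≤ {x = x} {y} le rewrite FP.toℕ-inject₁ x | FP.toℕ-inject₁ y = le

inject₁-≤⁻ : ∀ {n} {x y : Fin n} → inject₁ x F.≤ inject₁ y → x F.≤ y
inject₁-≤⁻ {x = x} {y} le rewrite FP.toℕ-inject₁ x | FP.toℕ-inject₁ y = le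

vec-ext : ∀ {a} {A : Set a} {n} {v w : Vec A n} → (∀ i → lookup v i ≡ lookup w i) → v ≡ w
vec-ext {v = v} {w} e = trans (sym (tabulate∘lookup v)) (trans (tabulate-cong e) (tabulate∘lookup w))

-- Orbits of a permutation.  `IsCycleMin` only inspects σ^m i for m < n;
-- since every point returns to itself within n steps, this is the same as
-- being the least element of the whole orbit.
module Orbit {n : ℕ} (σ : Vec (Fin n) n) (perm : IsPerm σ) where

  iter-+ : ∀ a b i → iter σ (a + b) i ≡ iter σ a (iter σ b i)
  iter-+ zero    b i = refl
  iter-+ (suc a) b i = cong (lookup σ) (iter-+ a b i)

  iter-cancel : ∀ a b i → iter σ a i ≡ iter σ (a + b) i → i ≡ iter σ b i
  iter-cancel zero    b i e = e
  iter-cancel (suc a) b i e = iter-cancel a b i (perm _ _ e)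

  iter-multiple : ∀ p i → iter σ p i ≡ i → ∀ q → iter σ (q * p) i ≡ i
  iter-multiple p i e zero    = refl
  iter-multiple p i e (suc q) = trans (iter-+ p (q * p) i) (trans (cong (iter σ p) (iter-multiple p i e q)) e)

  -- By pigeonhole among σ^0 i, …, σ^n i, each point has a period 0 < p ≤ n.
  period : ∀ i → ∃[ p ] (0 < p × p ≤ n × iter σ p i ≡ i)
  period i with FP.pigeonhole (n<1+n n) (λ (j : Fin (suc n)) → iter σ (toℕ j) i)
  ... | j₁ , j₂ , j₁<j₂ , e = p , m<n⇒0<n∸m j₁<j₂ , p≤n , sym (iter-cancel (toℕ j₁) p i e′)
    where
    p = toℕ j₂ ∸ toℕ j₁
    p≤n : p ≤ n
    p≤n = ≤-trans (m∸n≤m (toℕ j₂) (toℕ j₁)) (s≤s⁻¹ (FP.toℕ<n j₂))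
    e′ : iter σ (toℕ j₁) i ≡ iter σ (toℕ j₁ + p) i
    e′ = trans e (cong (λ k → iter σ k i) (sym (m+[n∸m]≡n (<⇒≤ j₁<j₂))))

  reduce : ∀ i m → ∃[ m′ ] (m′ < n × iter σ m i ≡ iter σ m′ i)
  reduce i m with period i
  ... | p@(suc _) , _ , p≤n , e = m % p , <-≤-trans (m%n<n m p) p≤n , (begin
    iter σ m i                               ≡⟨ cong (λ k → iter σ k i) (m≡m%n+[m/n]*n m p) ⟩
    iter σ (m % p + (m / p) * p) i           ≡⟨ iter-+ (m % p) ((m / p) * p) i ⟩
    iter σ (m % p) (iter σ ((m / p) * p) i)  ≡⟨ cong (iter σ (m % p)) (iter-multiple p i e (m / p)) ⟩
    iter σ (m % p) i                         ∎)
    where open ≡-Reasoning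

  cycleMin-all : ∀ i → IsCycleMin σ i → ∀ m → i F.≤ iter σ m i
  cycleMin-all i h m with reduce i m
  ... | m′ , m′<n , e =
    subst (i F.≤_) (trans (cong (λ k → iter σ k i) (FP.toℕ-fromℕ< m′<n)) (sym e)) (h (fromℕ< m′<n))

  -- Every point has a preimage (take σ^(p-1) for the period p).
  preimage-exists : ∀ y → ∃[ x ] lookup σ x ≡ y
  preimage-exists y with period y
  ... | suc p′ , _ , _ , e = iter σ p′ y , e

-- Deleting the top point L = n from a permutation of Fin (suc n): every
-- x is sent to σ x, except the preimage of L, which is sent to σ L.
-- This removes L from its cycle (and removes the cycle if it was (L)).
deleteTop : ∀ {n} → Vec (Fin (suc n)) (suc n) → Vec (Fin n) n
deleteTop σ = tabulate (λ x → lower (lower x (lookup σ (fromℕ _))) (lookup σ (inject₁ x)))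

restrict : ∀ {n k} → Vec (Fin k) (suc n) → Vec (Fin k) n
restrict col = tabulate (λ x → lookup col (inject₁ x))

restrict-lookup : ∀ {n k} (col : Vec (Fin k) (suc n)) x → lookup (restrict col) x ≡ lookup col (inject₁ x)
restrict-lookup col x = lookup∘tabulate _ x

deleteTop-old : ∀ {n} (σ : Vec (Fin (suc n)) (suc n)) x → lookup σ (inject₁ x) ≢ fromℕ n →
                inject₁ (lookup (deleteTop σ) x) ≡ lookup σ (inject₁ x)
deleteTop-old σ x ne rewrite lookup∘tabulate (λ x → lower (lower x (lookup σ (fromℕ _))) (lookup σ (inject₁ x))) x =
  lower-inject _ (lookup σ (inject₁ x)) ne

deleteTop-bypass : ∀ {n} (σ : Vec (Fin (suc n)) (suc n)) x → lookup σ (inject₁ x) ≡ fromℕ n →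
                   lookup σ (fromℕ n) ≢ fromℕ n → inject₁ (lookup (deleteTop σ) x) ≡ lookup σ (fromℕ n)
deleteTop-bypass σ x e ne
  rewrite lookup∘tabulate (λ x → lower (lower x (lookup σ (fromℕ _))) (lookup σ (inject₁ x))) x | e
        | caseTop-top (lower x (lookup σ (fromℕ _))) id = lower-inject x _ ne

module Delete {n : ℕ} (σ : Vec (Fin (suc n)) (suc n)) (perm : IsPerm σ) where
  L : Fin (suc n)
  L = fromℕ n

  next : Fin (suc n) → Fin (suc n)
  next = lookup σ

  σ′ : Vec (Fin n) n
  σ′ = deleteTop σ

  top-not-fixed : ∀ x → next (inject₁ x) ≡ L → next L ≢ L
  top-not-fixed x e e′ = FP.fromℕ≢inject₁ (perm _ _ (trans e′ (sym e)))

  deleted-old : ∀ x → next (inject₁ x) ≢ L → inject₁ (lookup σ′ x) ≡ next (inject₁ x)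
  deleted-old = deleteTop-old σ

  deleted-bypass : ∀ x → next (inject₁ x) ≡ L → inject₁ (lookup σ′ x) ≡ next L
  deleted-bypass x e = deleteTop-bypass σ x e (top-not-fixed x e)

  perm′ : IsPerm σ′
  perm′ x y e with next (inject₁ x) F.≟ L | next (inject₁ y) F.≟ L
  ... | yes ex | yes ey = FP.inject₁-injective (perm _ _ (trans ex (sym ey)))
  ... | yes ex | no ny  = ⊥-elim (FP.fromℕ≢inject₁ (perm _ _
                            (trans (sym (deleted-bypass x ex)) (trans (cong inject₁ e) (deleted-old y ny)))))
  ... | no nx  | yes ey = ⊥-elim (FP.fromℕ≢inject₁ (perm _ _
                            (trans (sym (deleted-bypass y ey)) (trans (cong inject₁ (sym e)) (deleted-old x nx)))))
  ... | no nx  | no ny  = FP.inject₁-injective (perm _ _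
                            (trans (sym (deleted-old x nx)) (trans (cong inject₁ e) (deleted-old y ny))))

  -- Orbits correspond: the σ′-orbit of i is the σ-orbit of i with L removed.
  orbit-σ′⊆σ : ∀ i m → ∃[ m′ ] inject₁ (iter σ′ m i) ≡ iter σ m′ (inject₁ i)
  orbit-σ′⊆σ i zero = 0 , refl
  orbit-σ′⊆σ i (suc m) with orbit-σ′⊆σ i m | next (inject₁ (iter σ′ m i)) F.≟ L
  ... | m′ , e | no ne = suc m′ , trans (deleted-old _ ne) (cong next e)
  ... | m′ , e | yes eq = suc (suc m′) , trans (deleted-bypass _ eq) (cong next (trans (sym eq) (cong next e)))

  orbit-σ⊆σ′ : ∀ i m′ → (∃[ m ] iter σ m′ (inject₁ i) ≡ inject₁ (iter σ′ m i))
                      ⊎ (iter σ m′ (inject₁ i) ≡ L × ∃[ m ] next L ≡ inject₁ (iter σ′ m i))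
  orbit-σ⊆σ′ i zero = inj₁ (0 , refl)
  orbit-σ⊆σ′ i (suc m′) with orbit-σ⊆σ′ i m′
  ... | inj₂ (e , m , e′) = inj₁ (m , trans (cong next e) e′)
  ... | inj₁ (m , e) with next (inject₁ (iter σ′ m i)) F.≟ L
  ...   | no ne  = inj₁ (suc m , trans (cong next e) (sym (deleted-old _ ne)))
  ...   | yes eq = inj₂ (trans (cong next e) eq , suc m , sym (deleted-bypass _ eq))

  private
    module O  = Orbit σ perm
    module O′ = Orbit σ′ perm′

  cycleMin-old→ : ∀ i → IsCycleMin σ (inject₁ i) → IsCycleMin σ′ i
  cycleMin-old→ i h m with orbit-σ′⊆σ i (F.toℕ m)
  ... | m′ , e = inject₁-≤⁻ (subst (inject₁ i F.≤_) (sym e) (O.cycleMin-all _ h m′))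

  cycleMin-old← : ∀ i → IsCycleMin σ′ i → IsCycleMin σ (inject₁ i)
  cycleMin-old← i h m′ with orbit-σ⊆σ′ i (F.toℕ m′)
  ... | inj₁ (m , e) = subst (inject₁ i F.≤_) (sym e) (inject₁-≤ (O′.cycleMin-all i h m))
  ... | inj₂ (e , _) = subst (inject₁ i F.≤_) (sym e) (≤-top (inject₁ i))

  cycleMin-top→ : IsCycleMin σ L → next L ≡ L
  cycleMin-top→ h = top≤⇒top (next L) (O.cycleMin-all L h 1)

  cycleMin-top← : next L ≡ L → IsCycleMin σ L
  cycleMin-top← e m = subst (L F.≤_) (sym (fixed (F.toℕ m))) (FP.≤-refl {x = L})
    where
    fixed : ∀ m → iter σ m L ≡ L
    fixed zero    = refl
    fixed (suc m) = trans (cong next (fixed m)) e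

  module _ {k : ℕ} (col : Vec (Fin k) (suc n)) where

    restrict-colouring : IsCycleColouring σ col → IsCycleColouring σ′ (restrict col)
    restrict-colouring cc x = begin
      lookup (restrict col) (lookup σ′ x)  ≡⟨ restrict-lookup col _ ⟩
      lookup col (inject₁ (lookup σ′ x))   ≡⟨ successor-colour ⟩
      lookup col (inject₁ x)               ≡⟨ restrict-lookup col x ⟨
      lookup (restrict col) x              ∎
      where
      open ≡-Reasoning
      successor-colour : lookup col (inject₁ (lookup σ′ x)) ≡ lookup col (inject₁ x)
      successor-colour with next (inject₁ x) F.≟ L
      ... | no ne  = trans (cong (lookup col) (deleted-old x ne)) (cc (inject₁ x))
      ... | yes eq = trans (cong (lookup col) (deleted-bypass x eq))
                           (trans (cc L) (trans (cong (lookup col) (sym eq)) (cc (inject₁ x))))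

    cycles-delete : ∀ c → cyclesOfColour σ col c
                        ≡ cyclesOfColour σ′ (restrict col) c + ind (next L F.≟ L) * ind (lookup col L F.≟ c)
    cycles-delete c = begin
      cyclesOfColour σ col c
        ≡⟨ trans (length-filter P? (allFin (suc n))) (sumL-allFin (suc n) _) ⟩
      sumF (suc n) (λ i → ind (P? i))
        ≡⟨ sumF-last n (λ i → ind (P? i)) ⟩
      sumF n (λ i → ind (P? (inject₁ i))) + ind (P? L)
        ≡⟨ cong₂ _+_ (sumF-cong n old) top ⟩
      sumF n (λ i → ind (P′? i)) + ind (next L F.≟ L) * ind (lookup col L F.≟ c)
        ≡⟨ cong (_+ ind (next L F.≟ L) * ind (lookup col L F.≟ c)) (trans (length-filter P′? (allFin n)) (sumL-allFin n _)) ⟨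
      cyclesOfColour σ′ (restrict col) c + ind (next L F.≟ L) * ind (lookup col L F.≟ c) ∎
      where
      open ≡-Reasoning
      P? : ∀ i → Dec (IsCycleMin σ i × lookup col i ≡ c)
      P? i = isCycleMin? σ i ×-dec (lookup col i F.≟ c)
      P′? : ∀ i → Dec (IsCycleMin σ′ i × lookup (restrict col) i ≡ c)
      P′? i = isCycleMin? σ′ i ×-dec (lookup (restrict col) i F.≟ c)
      old : ∀ i → ind (P? (inject₁ i)) ≡ ind (P′? i)
      old i = ind-cong (P? (inject₁ i)) (P′? i)
        (λ (m , e) → cycleMin-old→ i m , trans (restrict-lookup col i) e)
        (λ (m , e) → cycleMin-old← i m , trans (sym (restrict-lookup col i)) e)
      top : ind (P? L) ≡ ind (next L F.≟ L) * ind (lookup col L F.≟ c)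
      top = trans (ind-× (isCycleMin? σ L) (lookup col L F.≟ c))
                  (cong (_* ind (lookup col L F.≟ c)) (ind-cong (isCycleMin? σ L) (next L F.≟ L) cycleMin-top→ cycleMin-top←))

extend : ∀ {n k} → Vec (Fin k) n → Fin k → Vec (Fin k) (suc n)
extend col c = tabulate (caseTop c (lookup col))

extend-top : ∀ {n k} (col : Vec (Fin k) n) c → lookup (extend col c) (fromℕ n) ≡ c
extend-top {n} col c = trans (lookup∘tabulate (caseTop c (lookup col)) (fromℕ n)) (caseTop-top c (lookup col))

extend-old : ∀ {n k} (col : Vec (Fin k) n) c x → lookup (extend col c) (inject₁ x) ≡ lookup col x
extend-old col c x = trans (lookup∘tabulate (caseTop c (lookup col)) (inject₁ x)) (caseTop-old c (lookup col) x)

restrict-extend : ∀ {n k} (col : Vec (Fin k) n) c → restrict (extend col c) ≡ col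
restrict-extend col c = vec-ext λ x → trans (restrict-lookup (extend col c) x) (extend-old col c x)

extend-restrict : ∀ {n k} (col : Vec (Fin k) (suc n)) → extend (restrict col) (lookup col (fromℕ n)) ≡ col
extend-restrict {n} col = vec-ext entry
  where
  entry : ∀ y → lookup (extend (restrict col) (lookup col (fromℕ n))) y ≡ lookup col y
  entry y with view y
  ... | ‵fromℕ          = extend-top (restrict col) _
  ... | ‵inj₁ {i = x} _ = trans (extend-old (restrict col) _ x) (restrict-lookup col x)

insertFixed : ∀ {n} → Vec (Fin n) n → Vec (Fin (suc n)) (suc n)
insertFixed {n} σ = tabulate (caseTop (fromℕ n) (inject₁ ∘ lookup σ))

module InsertFixed {n : ℕ} (σ : Vec (Fin n) n) where
  S = insertFixed σ

  entries : ∀ y → lookup S y ≡ caseTop (fromℕ n) (inject₁ ∘ lookup σ) y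
  entries = lookup∘tabulate (caseTop (fromℕ n) (inject₁ ∘ lookup σ))

  top : lookup S (fromℕ n) ≡ fromℕ n
  top = trans (entries (fromℕ n)) (caseTop-top (fromℕ n) (inject₁ ∘ lookup σ))

  old : ∀ x → lookup S (inject₁ x) ≡ inject₁ (lookup σ x)
  old x = trans (entries (inject₁ x)) (caseTop-old (fromℕ n) (inject₁ ∘ lookup σ) x)

  perm : IsPerm σ → IsPerm S
  perm pσ y₁ y₂ e with view y₁ | view y₂
  ... | ‵fromℕ           | ‵fromℕ           = refl
  ... | ‵fromℕ           | ‵inj₁ {i = x} _  = ⊥-elim (FP.fromℕ≢inject₁ (trans (sym top) (trans e (old x))))
  ... | ‵inj₁ {i = x} _  | ‵fromℕ           = ⊥-elim (FP.fromℕ≢inject₁ (trans (sym top) (trans (sym e) (old x))))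
  ... | ‵inj₁ {i = x₁} _ | ‵inj₁ {i = x₂} _ =
    cong inject₁ (pσ x₁ x₂ (FP.inject₁-injective (trans (sym (old x₁)) (trans e (old x₂)))))

  colouring : ∀ {k} (col : Vec (Fin k) n) c → IsCycleColouring σ col → IsCycleColouring S (extend col c)
  colouring col c cc y with view y
  ... | ‵fromℕ          = cong (lookup (extend col c)) top
  ... | ‵inj₁ {i = x} _ = trans (cong (lookup (extend col c)) (old x))
                                (trans (extend-old col c _) (trans (cc x) (sym (extend-old col c x))))

  delete-insert : deleteTop S ≡ σ
  delete-insert = vec-ext λ x → FP.inject₁-injective (trans (deleteTop-old S x (not-top x)) (old x))
    where
    not-top : ∀ x → lookup S (inject₁ x) ≢ fromℕ n
    not-top x e = FP.fromℕ≢inject₁ (trans (sym e) (old x))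

insert-delete-fixed : ∀ {n} (σ : Vec (Fin (suc n)) (suc n)) → IsPerm σ → lookup σ (fromℕ n) ≡ fromℕ n →
                      insertFixed (deleteTop σ) ≡ σ
insert-delete-fixed {n} σ perm fixed = vec-ext entry
  where
  open InsertFixed (deleteTop σ) using (S; top; old)
  entry : ∀ y → lookup S y ≡ lookup σ y
  entry y with view y
  ... | ‵fromℕ          = trans top (sym fixed)
  ... | ‵inj₁ {i = x} _ = trans (old x) (deleteTop-old σ x λ e → FP.fromℕ≢inject₁ (perm _ _ (trans fixed (sym e))))

-- Inserting L into the cycle of p, right after p: p ↦ L ↦ σ p.
redirect : ∀ {n} → Vec (Fin n) n → Fin n → Fin n → Fin (suc n)
redirect {n} σ p x with x F.≟ p
... | yes _ = fromℕ n
... | no _  = inject₁ (lookup σ x)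

insertAfter : ∀ {n} → Vec (Fin n) n → Fin n → Vec (Fin (suc n)) (suc n)
insertAfter σ p = tabulate (caseTop (inject₁ (lookup σ p)) (redirect σ p))

module InsertAfter {n : ℕ} (σ : Vec (Fin n) n) (p : Fin n) where
  S = insertAfter σ p

  entries : ∀ y → lookup S y ≡ caseTop (inject₁ (lookup σ p)) (redirect σ p) y
  entries = lookup∘tabulate (caseTop (inject₁ (lookup σ p)) (redirect σ p))

  top : lookup S (fromℕ n) ≡ inject₁ (lookup σ p)
  top = trans (entries (fromℕ n)) (caseTop-top (inject₁ (lookup σ p)) (redirect σ p))

  at-p : lookup S (inject₁ p) ≡ fromℕ n
  at-p = trans (entries (inject₁ p)) (trans (caseTop-old (inject₁ (lookup σ p)) (redirect σ p) p) redirect-p)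
    where
    redirect-p : redirect σ p p ≡ fromℕ n
    redirect-p with p F.≟ p
    ... | yes _ = refl
    ... | no ne = ⊥-elim (ne refl)

  old : ∀ x → x ≢ p → lookup S (inject₁ x) ≡ inject₁ (lookup σ x)
  old x x≢p = trans (entries (inject₁ x)) (trans (caseTop-old (inject₁ (lookup σ p)) (redirect σ p) x) redirect-x)
    where
    redirect-x : redirect σ p x ≡ inject₁ (lookup σ x)
    redirect-x with x F.≟ p
    ... | yes e = ⊥-elim (x≢p e)
    ... | no _  = refl

  top-not-fixed : lookup S (fromℕ n) ≢ fromℕ n
  top-not-fixed e = FP.fromℕ≢inject₁ (trans (sym e) top)

  top≢old : IsPerm σ → ∀ x → lookup S (fromℕ n) ≢ lookup S (inject₁ x)
  top≢old pσ x e with x F.≟ p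
  ... | yes refl = FP.fromℕ≢inject₁ (trans (sym at-p) (trans (sym e) top))
  ... | no x≢p   = x≢p (pσ x p (FP.inject₁-injective (trans (sym (old x x≢p)) (trans (sym e) top))))

  perm : IsPerm σ → IsPerm S
  perm pσ y₁ y₂ e with view y₁ | view y₂
  ... | ‵fromℕ           | ‵fromℕ           = refl
  ... | ‵fromℕ           | ‵inj₁ {i = x} _  = ⊥-elim (top≢old pσ x e)
  ... | ‵inj₁ {i = x} _  | ‵fromℕ           = ⊥-elim (top≢old pσ x (sym e))
  ... | ‵inj₁ {i = x₁} _ | ‵inj₁ {i = x₂} _ with x₁ F.≟ p | x₂ F.≟ p
  ...   | yes refl | yes refl = refl
  ...   | yes refl | no ne₂   = ⊥-elim (FP.fromℕ≢inject₁ (trans (sym at-p) (trans e (old x₂ ne₂))))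
  ...   | no ne₁   | yes refl = ⊥-elim (FP.fromℕ≢inject₁ (trans (sym at-p) (trans (sym e) (old x₁ ne₁))))
  ...   | no ne₁   | no ne₂   =
    cong inject₁ (pσ x₁ x₂ (FP.inject₁-injective (trans (sym (old x₁ ne₁)) (trans e (old x₂ ne₂)))))

  colouring : ∀ {k} (col : Vec (Fin k) n) → IsCycleColouring σ col →
              IsCycleColouring S (extend col (lookup col p))
  colouring col cc = entry
    where
    colS = extend col (lookup col p)
    entry : IsCycleColouring S colS
    entry y with view y
    ... | ‵fromℕ          = trans (cong (lookup colS) top)
                                  (trans (extend-old col _ _) (trans (cc p) (sym (extend-top col _))))
    ... | ‵inj₁ {i = x} _ with x F.≟ p
    ...   | yes refl = trans (cong (lookup colS) at-p) (trans (extend-top col _) (sym (extend-old col _ x)))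
    ...   | no x≢p   = trans (cong (lookup colS) (old x x≢p))
                             (trans (extend-old col _ _) (trans (cc x) (sym (extend-old col _ x))))

  delete-insert : deleteTop S ≡ σ
  delete-insert = vec-ext λ x → FP.inject₁-injective (entry x)
    where
    entry : ∀ x → inject₁ (lookup (deleteTop S) x) ≡ inject₁ (lookup σ x)
    entry x with x F.≟ p
    ... | yes refl = trans (deleteTop-bypass S x at-p top-not-fixed) top
    ... | no x≢p   = trans (deleteTop-old S x not-top) (old x x≢p)
      where
      not-top : lookup S (inject₁ x) ≢ fromℕ n
      not-top e = FP.fromℕ≢inject₁ (trans (sym e) (old x x≢p))

insert-delete-after : ∀ {n} (σ : Vec (Fin (suc n)) (suc n)) → IsPerm σ → (p : Fin n) →
                      lookup σ (inject₁ p) ≡ fromℕ n → insertAfter (deleteTop σ) p ≡ σ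
insert-delete-after {n} σ perm p p↦L = vec-ext entry
  where
  open InsertAfter (deleteTop σ) p using (S; top; at-p; old)
  open Delete σ perm using (deleted-old; deleted-bypass)
  entry : ∀ y → lookup S y ≡ lookup σ y
  entry y with view y
  ... | ‵fromℕ          = trans top (deleted-bypass p p↦L)
  ... | ‵inj₁ {i = x} _ with x F.≟ p
  ...   | yes refl = trans at-p (sym p↦L)
  ...   | no x≢p   = trans (old x x≢p) (deleted-old x λ e → x≢p (FP.inject₁-injective (perm _ _ (trans e (sym p↦L)))))

Coloured : ℕ → ℕ → Set
Coloured n K = Vec (Fin n) n × Vec (Fin K) n

HasProfile : ∀ {n K} → (Fin K → ℕ) → Coloured n K → Set
HasProfile a (σ , col) =
  IsPerm σ × IsCycleColouring σ col × (∀ c → cyclesOfColour σ col c ≡ a c)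

hasProfile? : ∀ {n K} (a : Fin K → ℕ) (q : Coloured n K) → Dec (HasProfile a q)
hasProfile? a (σ , col) = isPerm? σ ×-dec isCycleColouring? σ col ×-dec
                          FP.all? (λ c → cyclesOfColour σ col c ≟ a c)

allColoured : (n K : ℕ) → List (Coloured n K)
allColoured n K = prodL (allVecs (allFin n) n) (allVecs (allFin K) n)

_≟C_ : ∀ {n K} → DecidableEquality (Coloured n K)
_≟C_ = ProdP.≡-dec (VecP.≡-dec F._≟_) (VecP.≡-dec F._≟_)

allColoured-once : ∀ n K → ExactlyOnce _≟C_ (allColoured n K)
allColoured-once n K = EO-prod (VecP.≡-dec F._≟_) (VecP.≡-dec F._≟_)
  (allVecs (allFin n) n) (allVecs (allFin K) n)
  (EO-allVecs F._≟_ (allFin n) (EO-allFin n) n) (EO-allVecs F._≟_ (allFin K) (EO-allFin K) n)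

colouredPerms : (n K : ℕ) → (Fin K → ℕ) → ℕ
colouredPerms n K a = sumL (allColoured n K) (λ q → ind (hasProfile? a q))

decrement : ∀ {K} → (Fin K → ℕ) → Fin K → Fin K → ℕ
decrement a c c′ = a c′ ∸ ind (c F.≟ c′)

-- Some preimage of y under f (y itself if there is none).
preimage : ∀ {n} → (Fin n → Fin n) → Fin n → Fin n
preimage f y with FP.any? (λ x → f x F.≟ y)
... | yes (x , _) = x
... | no _        = y

preimage-spec : ∀ {n} (f : Fin n → Fin n) y → ∃ (λ x → f x ≡ y) → f (preimage f y) ≡ y
preimage-spec f y ex with FP.any? (λ x → f x F.≟ y)
... | yes (_ , e) = e
... | no ne       = ⊥-elim (ne ex)

cycles-insertFixed : ∀ {n K} (σ : Vec (Fin n) n) (col : Vec (Fin K) n) c → IsPerm σ →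
  ∀ c′ → cyclesOfColour (insertFixed σ) (extend col c) c′ ≡ cyclesOfColour σ col c′ + ind (c F.≟ c′)
cycles-insertFixed {n} σ col c pσ c′ = begin
  cyclesOfColour S colS c′
    ≡⟨ Delete.cycles-delete S (I.perm pσ) colS c′ ⟩
  cyclesOfColour (deleteTop S) (restrict colS) c′ + topTerm
    ≡⟨ cong₂ (λ τ κ → cyclesOfColour τ κ c′ + topTerm) I.delete-insert (restrict-extend col c) ⟩
  cyclesOfColour σ col c′ + topTerm
    ≡⟨ cong (cyclesOfColour σ col c′ +_) (cong₂ _*_ (ind-yes (lookup S L F.≟ L) I.top)
                                                   (cong (λ z → ind (z F.≟ c′)) (extend-top col c))) ⟩
  cyclesOfColour σ col c′ + 1 * ind (c F.≟ c′)
    ≡⟨ cong (cyclesOfColour σ col c′ +_) (*-identityˡ _) ⟩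
  cyclesOfColour σ col c′ + ind (c F.≟ c′) ∎
  where
  open ≡-Reasoning
  module I = InsertFixed σ
  S = insertFixed σ
  colS = extend col c
  L = fromℕ n
  topTerm = ind (lookup S L F.≟ L) * ind (lookup colS L F.≟ c′)

cycles-insertAfter : ∀ {n K} (σ : Vec (Fin n) n) (col : Vec (Fin K) n) p → IsPerm σ →
  ∀ c′ → cyclesOfColour (insertAfter σ p) (extend col (lookup col p)) c′ ≡ cyclesOfColour σ col c′
cycles-insertAfter {n} σ col p pσ c′ = begin
  cyclesOfColour S colS c′
    ≡⟨ Delete.cycles-delete S (I.perm pσ) colS c′ ⟩
  cyclesOfColour (deleteTop S) (restrict colS) c′ + topTerm
    ≡⟨ cong₂ (λ τ κ → cyclesOfColour τ κ c′ + topTerm) I.delete-insert (restrict-extend col _) ⟩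
  cyclesOfColour σ col c′ + topTerm
    ≡⟨ cong (λ z → cyclesOfColour σ col c′ + z * ind (lookup colS L F.≟ c′))
            (ind-no (lookup S L F.≟ L) I.top-not-fixed) ⟩
  cyclesOfColour σ col c′ + 0
    ≡⟨ +-identityʳ _ ⟩
  cyclesOfColour σ col c′ ∎
  where
  open ≡-Reasoning
  module I = InsertAfter σ p
  S = insertAfter σ p
  colS = extend col (lookup col p)
  L = fromℕ n
  topTerm = ind (lookup S L F.≟ L) * ind (lookup colS L F.≟ c′)

decrement-restore : ∀ {K} (a : Fin K → ℕ) c → 1 ≤ a c → ∀ c′ → decrement a c c′ + ind (c F.≟ c′) ≡ a c′
decrement-restore a c 1≤ac c′ with c F.≟ c′
... | yes refl = m∸n+n≡m 1≤ac
... | no _     = +-identityʳ (a c′)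

topFixed? : ∀ {n K} (a : Fin K → ℕ) (q : Coloured (suc n) K) →
            Dec (HasProfile a q × lookup (proj₁ q) (fromℕ n) ≡ fromℕ n)
topFixed? {n} a q = hasProfile? a q ×-dec (lookup (proj₁ q) (fromℕ n) F.≟ fromℕ n)

topMoved? : ∀ {n K} (a : Fin K → ℕ) (q : Coloured (suc n) K) →
            Dec (HasProfile a q × ¬ lookup (proj₁ q) (fromℕ n) ≡ fromℕ n)
topMoved? {n} a q = hasProfile? a q ×-dec ¬? (lookup (proj₁ q) (fromℕ n) F.≟ fromℕ n)

-- Coloured permutations of Fin (suc n) fixing the top point L correspond
-- to a colour c (that of the 1-cycle (L)) together with a coloured
-- permutation of Fin n having one fewer cycle of colour c.
module TopFixed (n K : ℕ) (a : Fin K → ℕ) where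
  L = fromℕ n

  Fixed : Coloured (suc n) K → Set
  Fixed q = HasProfile a q × lookup (proj₁ q) L ≡ L

  Smaller : Fin K × Coloured n K → Set
  Smaller (c , q) = 1 ≤ a c × HasProfile (decrement a c) q

  smaller? : ∀ p → Dec (Smaller p)
  smaller? (c , q) = (1 ≤? a c) ×-dec hasProfile? (decrement a c) q

  remove : Coloured (suc n) K → Fin K × Coloured n K
  remove (σ , col) = lookup col L , deleteTop σ , restrict col

  add : Fin K × Coloured n K → Coloured (suc n) K
  add (c , σ′ , col′) = insertFixed σ′ , extend col′ c

  remove-ok : ∀ q → Fixed q → Smaller (remove q)
  remove-ok (σ , col) ((pσ , cc , cnt) , fixed) =
    colour-present , D.perm′ , D.restrict-colouring col cc ,
    λ c′ → sym (trans (cong (_∸ ind (ℓ F.≟ c′)) (counts c′)) (m+n∸n≡m (cyc c′) (ind (ℓ F.≟ c′))))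
    where
    module D = Delete σ pσ
    ℓ = lookup col L
    cyc : Fin K → ℕ
    cyc = cyclesOfColour (deleteTop σ) (restrict col)
    -- the 1-cycle (L) accounts for one cycle of L's colour ℓ
    counts : ∀ c′ → a c′ ≡ cyc c′ + ind (ℓ F.≟ c′)
    counts c′ = begin
      a c′                                                ≡⟨ cnt c′ ⟨
      cyclesOfColour σ col c′                             ≡⟨ D.cycles-delete col c′ ⟩
      cyc c′ + ind (lookup σ L F.≟ L) * ind (ℓ F.≟ c′)
        ≡⟨ cong (λ z → cyc c′ + z * ind (ℓ F.≟ c′)) (ind-yes (lookup σ L F.≟ L) fixed) ⟩
      cyc c′ + 1 * ind (ℓ F.≟ c′)                         ≡⟨ cong (cyc c′ +_) (*-identityˡ _) ⟩
      cyc c′ + ind (ℓ F.≟ c′)                             ∎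
      where open ≡-Reasoning
    colour-present : 1 ≤ a ℓ
    colour-present = subst (1 ≤_) (sym (counts ℓ))
      (subst (λ z → 1 ≤ cyc ℓ + z) (sym (ind-yes (ℓ F.≟ ℓ) refl)) (m≤n+m 1 (cyc ℓ)))

  add-ok : ∀ p → Smaller p → Fixed (add p)
  add-ok (c , σ′ , col′) (1≤ac , pσ′ , cc′ , cnt′) =
    (I.perm pσ′ , I.colouring col′ c cc′ ,
     λ c′ → trans (cycles-insertFixed σ′ col′ c pσ′ c′)
                  (trans (cong (_+ ind (c F.≟ c′)) (cnt′ c′)) (decrement-restore a c 1≤ac c′))) ,
    I.top
    where module I = InsertFixed σ′

  add-remove : ∀ q → Fixed q → add (remove q) ≡ q
  add-remove (σ , col) ((pσ , _) , fixed) = cong₂ _,_ (insert-delete-fixed σ pσ fixed) (extend-restrict col)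

  remove-add : ∀ p → Smaller p → remove (add p) ≡ p
  remove-add (c , σ′ , col′) _ =
    cong₂ _,_ (extend-top col′ c) (cong₂ _,_ (InsertFixed.delete-insert σ′) (restrict-extend col′ c))

  count : sumL (allColoured (suc n) K) (λ q → ind (topFixed? a q))
        ≡ sumF K (λ c → ind (1 ≤? a c) * colouredPerms n K (decrement a c))
  count = begin
    sumL (allColoured (suc n) K) (λ q → ind (topFixed? a q))
      ≡⟨ bij-count _≟C_ (ProdP.≡-dec F._≟_ _≟C_) (allColoured (suc n) K) (prodL (allFin K) (allColoured n K))
                   (allColoured-once (suc n) K)
                   (EO-prod F._≟_ _≟C_ (allFin K) (allColoured n K) (EO-allFin K) (allColoured-once n K))
                   (topFixed? a) smaller? remove add remove-ok add-ok add-remove remove-add ⟩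
    sumL (prodL (allFin K) (allColoured n K)) (λ p → ind (smaller? p))
      ≡⟨ trans (sumL-prod (allFin K) (allColoured n K) _) (sumL-allFin K _) ⟩
    sumF K (λ c → sumL (allColoured n K) (λ q → ind (smaller? (c , q))))
      ≡⟨ sumF-cong K (λ c → trans (sumL-cong (allColoured n K) (λ q → ind-× (1 ≤? a c) (hasProfile? (decrement a c) q)))
                                  (sumL-*ˡ (allColoured n K) (ind (1 ≤? a c)) _)) ⟩
    sumF K (λ c → ind (1 ≤? a c) * colouredPerms n K (decrement a c)) ∎
    where open ≡-Reasoning

-- Coloured permutations of Fin (suc n) moving L correspond to a point
-- p of Fin n (the predecessor of L in its cycle) together with a coloured
-- permutation of Fin n of the same profile: L is inserted right after p.
-- The parameter d is any point of Fin n (it is only a default value).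
module TopMoved (n K : ℕ) (a : Fin K → ℕ) (d : Fin n) where
  L = fromℕ n

  Moved : Coloured (suc n) K → Set
  Moved q = HasProfile a q × lookup (proj₁ q) L ≢ L

  Rest : Fin n × Coloured n K → Set
  Rest (_ , q) = HasProfile a q

  rest? : ∀ p → Dec (Rest p)
  rest? (_ , q) = hasProfile? a q

  predecessor : Vec (Fin (suc n)) (suc n) → Fin n
  predecessor σ = lower d (preimage (lookup σ) L)

  predecessor-spec : ∀ σ → IsPerm σ → lookup σ L ≢ L → lookup σ (inject₁ (predecessor σ)) ≡ L
  predecessor-spec σ pσ moved = trans (cong (lookup σ) (lower-inject d q q≢L)) σq≡L
    where
    q = preimage (lookup σ) L
    σq≡L : lookup σ q ≡ L
    σq≡L = preimage-spec (lookup σ) L (Orbit.preimage-exists σ pσ L)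
    q≢L : q ≢ L
    q≢L q≡L = moved (trans (cong (lookup σ) (sym q≡L)) σq≡L)

  remove : Coloured (suc n) K → Fin n × Coloured n K
  remove (σ , col) = predecessor σ , deleteTop σ , restrict col

  add : Fin n × Coloured n K → Coloured (suc n) K
  add (p , σ′ , col′) = insertAfter σ′ p , extend col′ (lookup col′ p)

  remove-ok : ∀ q → Moved q → Rest (remove q)
  remove-ok (σ , col) ((pσ , cc , cnt) , moved) = D.perm′ , D.restrict-colouring col cc , counts
    where
    module D = Delete σ pσ
    counts : ∀ c′ → cyclesOfColour (deleteTop σ) (restrict col) c′ ≡ a c′
    counts c′ = begin
      cyclesOfColour (deleteTop σ) (restrict col) c′ ≡⟨ +-identityʳ _ ⟨
      cyclesOfColour (deleteTop σ) (restrict col) c′ + 0 * ind (lookup col L F.≟ c′)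
        ≡⟨ cong (λ z → cyclesOfColour (deleteTop σ) (restrict col) c′ + z * ind (lookup col L F.≟ c′))
                (ind-no (lookup σ L F.≟ L) moved) ⟨
      cyclesOfColour (deleteTop σ) (restrict col) c′ + ind (lookup σ L F.≟ L) * ind (lookup col L F.≟ c′)
        ≡⟨ D.cycles-delete col c′ ⟨
      cyclesOfColour σ col c′ ≡⟨ cnt c′ ⟩
      a c′ ∎
      where open ≡-Reasoning

  add-ok : ∀ p → Rest p → Moved (add p)
  add-ok (p , σ′ , col′) (pσ′ , cc′ , cnt′) =
    (I.perm pσ′ , I.colouring col′ cc′ , λ c′ → trans (cycles-insertAfter σ′ col′ p pσ′ c′) (cnt′ c′)) ,
    I.top-not-fixed
    where module I = InsertAfter σ′ p

  add-remove : ∀ q → Moved q → add (remove q) ≡ q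
  add-remove (σ , col) ((pσ , cc , _) , moved) =
    cong₂ _,_ (insert-delete-after σ pσ p p↦L)
              (trans (cong (extend (restrict col)) colour-p) (extend-restrict col))
    where
    p = predecessor σ
    p↦L = predecessor-spec σ pσ moved
    -- p and L lie on the same cycle, hence have the same colour
    colour-p : lookup (restrict col) p ≡ lookup col L
    colour-p = trans (restrict-lookup col p) (trans (sym (cc (inject₁ p))) (cong (lookup col) p↦L))

  remove-add : ∀ p → Rest p → remove (add p) ≡ p
  remove-add (p , σ′ , col′) (pσ′ , _) =
    cong₂ _,_ predecessor-p (cong₂ _,_ I.delete-insert (restrict-extend col′ _))
    where
    module I = InsertAfter σ′ p
    q = preimage (lookup I.S) L
    q≡p : q ≡ inject₁ p
    q≡p = I.perm pσ′ _ _ (trans (preimage-spec (lookup I.S) L (inject₁ p , I.at-p)) (sym I.at-p))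
    predecessor-p : predecessor I.S ≡ p
    predecessor-p = trans (cong (lower d) q≡p) (caseTop-old d id p)

  count : sumL (allColoured (suc n) K) (λ q → ind (topMoved? a q)) ≡ n * colouredPerms n K a
  count = begin
    sumL (allColoured (suc n) K) (λ q → ind (topMoved? a q))
      ≡⟨ bij-count _≟C_ (ProdP.≡-dec F._≟_ _≟C_) (allColoured (suc n) K) (prodL (allFin n) (allColoured n K))
                   (allColoured-once (suc n) K)
                   (EO-prod F._≟_ _≟C_ (allFin n) (allColoured n K) (EO-allFin n) (allColoured-once n K))
                   (topMoved? a) rest? remove add remove-ok add-ok add-remove remove-add ⟩
    sumL (prodL (allFin n) (allColoured n K)) (λ p → ind (rest? p))
      ≡⟨ trans (sumL-prod (allFin n) (allColoured n K) _) (sumL-allFin n _) ⟩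
    sumF n (λ _ → colouredPerms n K a)  ≡⟨ sumF-const n _ ⟩
    n * colouredPerms n K a ∎
    where open ≡-Reasoning

fin1-unique : ∀ (x y : Fin 1) → x ≡ y
fin1-unique zero zero = refl

-- On Fin 1 the only map fixes the top point, so nothing moves it.
moved-count : ∀ n K a → sumL (allColoured (suc n) K) (λ q → ind (topMoved? a q)) ≡ n * colouredPerms n K a
moved-count zero    K a = trans (sumL-cong (allColoured 1 K) none) (sumL-0 (allColoured 1 K))
  where
  none : ∀ q → ind (topMoved? a q) ≡ 0
  none (σ , col) = ind-no (topMoved? a (σ , col)) λ (_ , moved) → moved (fin1-unique _ _)
moved-count (suc n) K a = TopMoved.count (suc n) K a zero

-- The recurrence: L is either a new 1-cycle of some colour c, or is
-- inserted after one of the n old points.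
colouredPerms-suc : ∀ n K a → colouredPerms (suc n) K a
  ≡ sumF K (λ c → ind (1 ≤? a c) * colouredPerms n K (decrement a c)) + n * colouredPerms n K a
colouredPerms-suc n K a = begin
  colouredPerms (suc n) K a
    ≡⟨ sumL-cong (allColoured (suc n) K) (λ q → ind-split (hasProfile? a q) (lookup (proj₁ q) (fromℕ n) F.≟ fromℕ n)) ⟩
  sumL (allColoured (suc n) K) (λ q → ind (topFixed? a q) + ind (topMoved? a q))
    ≡⟨ sumL-+ (allColoured (suc n) K) _ _ ⟩
  sumL (allColoured (suc n) K) (λ q → ind (topFixed? a q)) + sumL (allColoured (suc n) K) (λ q → ind (topMoved? a q))
    ≡⟨ cong₂ _+_ (TopFixed.count n K a) (moved-count n K a) ⟩
  sumF K (λ c → ind (1 ≤? a c) * colouredPerms n K (decrement a c)) + n * colouredPerms n K a ∎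
  where open ≡-Reasoning

-- There is exactly one coloured permutation of the empty set; its profile is 0.
colouredPerms-zero : ∀ K a → colouredPerms 0 K a ≡ ind (FP.all? (λ c → a c ≟ 0))
colouredPerms-zero K a = trans (+-identityʳ _)
  (ind-cong (hasProfile? a ([] , [])) (FP.all? (λ c → a c ≟ 0))
            (λ (_ , _ , h) c → sym (h c)) (λ h → (λ ()) , (λ ()) , λ c → sym (h c)))

s : ℕ → ℕ → ℕ
s zero    zero    = 1
s zero    (suc m) = 0
s (suc n) zero    = 0
s (suc n) (suc m) = n * s n (suc m) + s n m

n*s[n,0]≡0 : ∀ n → n * s n 0 ≡ 0
n*s[n,0]≡0 zero    = refl
n*s[n,0]≡0 (suc n) = *-zeroʳ (suc n)

s-below : ∀ j m → j < m → s j m ≡ 0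
s-below zero    (suc m) _         = refl
s-below (suc j) (suc m) (s≤s j<m)
  rewrite s-below j (suc m) (m<n⇒m<1+n j<m) | s-below j m j<m = trans (+-identityʳ (j * 0)) (*-zeroʳ j)

-- The recurrence for m! s(n, m), the shape shared by both closed forms below:
-- m! s(n+1, m) = n · m! s(n, m) + m · (m-1)! s(n, m-1).
factorial-s-suc : ∀ n m → m ! * s (suc n) m ≡ n * (m ! * s n m) + m * ((m ∸ 1) ! * s n (m ∸ 1))
factorial-s-suc n zero    = sym (trans (+-identityʳ _) (trans (cong (n *_) (+-identityʳ (s n 0))) (n*s[n,0]≡0 n)))
factorial-s-suc n (suc m) = expand m n (s n (suc m)) (s n m) (m !)
  where
  expand : ∀ m n x y f → suc m * f * (n * x + y) ≡ n * (suc m * f * x) + suc m * (f * y)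
  expand = solve-∀

prodF : (K : ℕ) → (Fin K → ℕ) → ℕ
prodF zero    f = 1
prodF (suc K) f = f zero * prodF K (λ i → f (suc i))

prodF-cong : ∀ K {f g : Fin K → ℕ} → (∀ i → f i ≡ g i) → prodF K f ≡ prodF K g
prodF-cong zero    e = refl
prodF-cong (suc K) e = cong₂ _*_ (e zero) (prodF-cong K (λ i → e (suc i)))

decrement-zero-suc : ∀ {K} (a : Fin (suc K) → ℕ) c → decrement a zero (suc c) ≡ a (suc c)
decrement-zero-suc a c = cong (a (suc c) ∸_) (ind-no (zero F.≟ suc c) (λ ()))

decrement-suc-suc : ∀ {K} (a : Fin (suc K) → ℕ) c c′ →
                    decrement a (suc c) (suc c′) ≡ decrement (λ i → a (suc i)) c c′
decrement-suc-suc a c c′ = cong (a (suc c′) ∸_) (ind-cong (suc c F.≟ suc c′) (c F.≟ c′) FP.suc-injective (cong suc))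

sumF-decrement : ∀ K (a : Fin K → ℕ) c → 1 ≤ a c → suc (sumF K (decrement a c)) ≡ sumF K a
sumF-decrement (suc K) a zero 1≤a₀ =
  cong₂ _+_ (trans (+-comm 1 (a zero ∸ 1)) (m∸n+n≡m 1≤a₀)) (sumF-cong K (decrement-zero-suc a))
sumF-decrement (suc K) a (suc c) 1≤ac = begin
  suc (a zero ∸ 0 + sumF K (λ i → decrement a (suc c) (suc i)))  ≡⟨ +-suc (a zero) _ ⟨
  a zero + suc (sumF K (λ i → decrement a (suc c) (suc i)))
    ≡⟨ cong (λ z → a zero + suc z) (sumF-cong K (decrement-suc-suc a c)) ⟩
  a zero + suc (sumF K (decrement (λ i → a (suc i)) c))
    ≡⟨ cong (a zero +_) (sumF-decrement K (λ i → a (suc i)) c 1≤ac) ⟩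
  a zero + sumF K (λ i → a (suc i))                              ∎
  where open ≡-Reasoning

prodF-decrement : ∀ K (a : Fin K → ℕ) c → 1 ≤ a c →
                  a c * prodF K (λ c′ → decrement a c c′ !) ≡ prodF K (λ c′ → a c′ !)
prodF-decrement (suc K) a zero 1≤a₀ with a zero
... | suc m = begin
  suc m * (m ! * prodF K (λ i → decrement a zero (suc i) !))
    ≡⟨ cong (λ z → suc m * (m ! * z)) (prodF-cong K (λ i → cong _! (decrement-zero-suc a i))) ⟩
  suc m * (m ! * prodF K (λ i → a (suc i) !))                 ≡⟨ *-assoc (suc m) (m !) _ ⟨
  suc m ! * prodF K (λ i → a (suc i) !)                       ∎
  where open ≡-Reasoning
prodF-decrement (suc K) a (suc c) 1≤ac = begin
  a (suc c) * (a zero ! * prodF K (λ i → decrement a (suc c) (suc i) !))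
    ≡⟨ cong (λ z → a (suc c) * (a zero ! * z)) (prodF-cong K (λ i → cong _! (decrement-suc-suc a c i))) ⟩
  a (suc c) * (a zero ! * prodF K (λ i → decrement (λ j → a (suc j)) c i !))
    ≡⟨ x*[y*z]≡y*[x*z] (a (suc c)) (a zero !) _ ⟩
  a zero ! * (a (suc c) * prodF K (λ i → decrement (λ j → a (suc j)) c i !))
    ≡⟨ cong (a zero ! *_) (prodF-decrement K (λ i → a (suc i)) c 1≤ac) ⟩
  a zero ! * prodF K (λ i → a (suc i) !) ∎
  where open ≡-Reasoning

sumF≡0⇒zeros : ∀ K (a : Fin K → ℕ) → sumF K a ≡ 0 → ∀ c → a c ≡ 0
sumF≡0⇒zeros (suc K) a e zero    = m+n≡0⇒m≡0 (a zero) e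
sumF≡0⇒zeros (suc K) a e (suc c) = sumF≡0⇒zeros K (λ i → a (suc i)) (m+n≡0⇒n≡0 (a zero) e) c

sumF-zeros : ∀ K (a : Fin K → ℕ) → (∀ c → a c ≡ 0) → sumF K a ≡ 0
sumF-zeros zero    a h = refl
sumF-zeros (suc K) a h rewrite h zero = sumF-zeros K (λ i → a (suc i)) (λ c → h (suc c))

prodF-factorial-zeros : ∀ K (a : Fin K → ℕ) → (∀ c → a c ≡ 0) → prodF K (λ c → a c !) ≡ 1
prodF-factorial-zeros zero    a h = refl
prodF-factorial-zeros (suc K) a h rewrite h zero =
  trans (+-identityʳ _) (prodF-factorial-zeros K (λ i → a (suc i)) (λ c → h (suc c)))

colouredPerms-closed-zero : ∀ K a → prodF K (λ c → a c !) * colouredPerms 0 K a ≡ (sumF K a) ! * s 0 (sumF K a)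
colouredPerms-closed-zero K a rewrite colouredPerms-zero K a with FP.all? (λ c → a c ≟ 0)
... | yes all0 rewrite prodF-factorial-zeros K a all0 | sumF-zeros K a all0 = refl
... | no ¬all0 with sumF K a in eq
...   | zero  = ⊥-elim (¬all0 (sumF≡0⇒zeros K a eq))
...   | suc m = trans (*-zeroʳ (prodF K (λ c → a c !))) (sym (*-zeroʳ (suc m !)))

-- Closed form: a_1! ⋯ a_K! · #(profile a on n points) = (Σ a)! · s(n, Σ a).
-- (Both sides satisfy the recurrence of `factorial-s-suc`.)
colouredPerms-closed : ∀ n K a → prodF K (λ c → a c !) * colouredPerms n K a ≡ (sumF K a) ! * s n (sumF K a)
colouredPerms-closed zero    K a = colouredPerms-closed-zero K a
colouredPerms-closed (suc n) K a = begin
  F * colouredPerms (suc n) K a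
    ≡⟨ cong (F *_) (colouredPerms-suc n K a) ⟩
  F * (sumF K (λ c → ind (1 ≤? a c) * colouredPerms n K (decrement a c)) + n * colouredPerms n K a)
    ≡⟨ *-distribˡ-+ F _ _ ⟩
  F * sumF K (λ c → ind (1 ≤? a c) * colouredPerms n K (decrement a c)) + F * (n * colouredPerms n K a)
    ≡⟨ cong₂ _+_ (sym (sumF-*ˡ K _ F)) (trans (x*[y*z]≡y*[x*z] F n _) (cong (n *_) (colouredPerms-closed n K a))) ⟩
  sumF K (λ c → F * (ind (1 ≤? a c) * colouredPerms n K (decrement a c))) + n * (Σ ! * s n Σ)
    ≡⟨ cong (_+ n * (Σ ! * s n Σ)) (trans (sumF-cong K new-cycle) (sumF-*ʳ K a _)) ⟩
  Σ * ((Σ ∸ 1) ! * s n (Σ ∸ 1)) + n * (Σ ! * s n Σ)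
    ≡⟨ trans (+-comm (Σ * ((Σ ∸ 1) ! * s n (Σ ∸ 1))) _) (sym (factorial-s-suc n Σ)) ⟩
  Σ ! * s (suc n) Σ ∎
  where
  open ≡-Reasoning
  F = prodF K (λ c → a c !)
  Σ = sumF K a
  new-cycle : ∀ c → F * (ind (1 ≤? a c) * colouredPerms n K (decrement a c)) ≡ a c * ((Σ ∸ 1) ! * s n (Σ ∸ 1))
  new-cycle c with 1 ≤? a c
  ... | no ¬1≤ac = trans (*-zeroʳ F) (sym (cong (_* ((Σ ∸ 1) ! * s n (Σ ∸ 1))) (n<1⇒n≡0 (≰⇒> ¬1≤ac))))
  ... | yes 1≤ac = begin
    F * (1 * colouredPerms n K (decrement a c))
      ≡⟨ cong₂ _*_ (sym (prodF-decrement K a c 1≤ac)) (*-identityˡ _) ⟩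
    a c * prodF K (λ c′ → decrement a c c′ !) * colouredPerms n K (decrement a c)
      ≡⟨ *-assoc (a c) _ _ ⟩
    a c * (prodF K (λ c′ → decrement a c c′ !) * colouredPerms n K (decrement a c))
      ≡⟨ cong (a c *_) (colouredPerms-closed n K (decrement a c)) ⟩
    a c * (sumF K (decrement a c) ! * s n (sumF K (decrement a c)))
      ≡⟨ cong (λ z → a c * (z ! * s n z)) (cong (_∸ 1) (sumF-decrement K a c 1≤ac)) ⟩
    a c * ((Σ ∸ 1) ! * s n (Σ ∸ 1)) ∎

Σ≤ : ℕ → (ℕ → ℕ) → ℕ
Σ≤ zero    f = f 0
Σ≤ (suc n) f = f 0 + Σ≤ n (λ j → f (suc j))

Σ≤-cong : ∀ n {f g : ℕ → ℕ} → (∀ j → j ≤ n → f j ≡ g j) → Σ≤ n f ≡ Σ≤ n g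
Σ≤-cong zero    e = e 0 z≤n
Σ≤-cong (suc n) e = cong₂ _+_ (e 0 z≤n) (Σ≤-cong n (λ j j≤n → e (suc j) (s≤s j≤n)))

Σ≤-last : ∀ n f → Σ≤ (suc n) f ≡ Σ≤ n f + f (suc n)
Σ≤-last zero    f = refl
Σ≤-last (suc n) f = trans (cong (f 0 +_) (Σ≤-last n (λ j → f (suc j)))) (sym (+-assoc (f 0) _ _))

Σ≤-+ : ∀ n f g → Σ≤ n (λ j → f j + g j) ≡ Σ≤ n f + Σ≤ n g
Σ≤-+ zero    f g = refl
Σ≤-+ (suc n) f g = trans (cong (f 0 + g 0 +_) (Σ≤-+ n (λ j → f (suc j)) (λ j → g (suc j))))
                         (exchange (f 0) (g 0) _ _)
  where
  exchange : ∀ a b c d → a + b + (c + d) ≡ a + c + (b + d)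
  exchange = solve-∀

Σ≤-*ˡ : ∀ n k f → Σ≤ n (λ j → k * f j) ≡ k * Σ≤ n f
Σ≤-*ˡ zero    k f = refl
Σ≤-*ˡ (suc n) k f = trans (cong (k * f 0 +_) (Σ≤-*ˡ n k (λ j → f (suc j)))) (sym (*-distribˡ-+ k (f 0) _))

Σ≤-zero : ∀ n f → (∀ j → f j ≡ 0) → Σ≤ n f ≡ 0
Σ≤-zero zero    f e = e 0
Σ≤-zero (suc n) f e = cong₂ _+_ (e 0) (Σ≤-zero n (λ j → f (suc j)) (λ j → e (suc j)))

-- Binomial convolution Σ_j C(n,j) A(j) B(n-j) (exponential generating
-- functions multiply).
conv : (ℕ → ℕ) → (ℕ → ℕ) → ℕ → ℕ
conv A B n = Σ≤ n (λ j → (n C j) * A j * B (n ∸ j))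

-- If A(j+1) = j·A(j) + A′(j) and B(j+1) = j·B(j) + B′(j), then the
-- convolution satisfies the analogous recurrence (Leibniz rule).
module ConvolutionRecurrence (A A′ B B′ : ℕ → ℕ)
  (recA : ∀ j → A (suc j) ≡ j * A j + A′ j) (recB : ∀ j → B (suc j) ≡ j * B j + B′ j) where

  -- Pascal's rule splits conv A B (n+1) into "j+1 from A" and "j from A" parts.
  pascal-split : ∀ n → conv A B (suc n) ≡ Σ≤ n (λ j → (n C j) * A (suc j) * B (n ∸ j))
                                         + Σ≤ n (λ j → (n C j) * A j * B (suc (n ∸ j)))
  pascal-split n = begin
    1 * A 0 * B (suc n) + Σ≤ n (λ j → (suc n C suc j) * A (suc j) * B (n ∸ j))
      ≡⟨ cong (1 * A 0 * B (suc n) +_) (trans (Σ≤-cong n (λ j _ → pascal j)) (Σ≤-+ n _ _)) ⟩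
    1 * A 0 * B (suc n) + (First + Σ≤ n (λ j → (n C suc j) * A (suc j) * B (n ∸ j)))
      ≡⟨ swap (1 * A 0 * B (suc n)) First _ ⟩
    First + Σ≤ (suc n) (λ j → (n C j) * A j * B (suc n ∸ j))
      ≡⟨ cong (First +_) (Σ≤-last n _) ⟩
    First + (Σ≤ n (λ j → (n C j) * A j * B (suc n ∸ j)) + (n C suc n) * A (suc n) * B (n ∸ n))
      ≡⟨ cong (λ z → First + (Σ≤ n (λ j → (n C j) * A j * B (suc n ∸ j)) + z * A (suc n) * B (n ∸ n)))
              (k>n⇒nCk≡0 (n<1+n n)) ⟩
    First + (Σ≤ n (λ j → (n C j) * A j * B (suc n ∸ j)) + 0)
      ≡⟨ cong (First +_) (trans (+-identityʳ _)
                                (Σ≤-cong n (λ j j≤n → cong (λ z → (n C j) * A j * B z) (+-∸-assoc 1 j≤n)))) ⟩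
    First + Σ≤ n (λ j → (n C j) * A j * B (suc (n ∸ j))) ∎
    where
    open ≡-Reasoning
    First = Σ≤ n (λ j → (n C j) * A (suc j) * B (n ∸ j))
    pascal : ∀ j → (suc n C suc j) * A (suc j) * B (n ∸ j)
                 ≡ (n C j) * A (suc j) * B (n ∸ j) + (n C suc j) * A (suc j) * B (n ∸ j)
    pascal j = trans (cong (λ z → z * A (suc j) * B (n ∸ j)) (sym (nCk+nC[k+1]≡[n+1]C[k+1] n j)))
                     (distrib (n C j) (n C suc j) (A (suc j)) (B (n ∸ j)))
      where
      distrib : ∀ a b c d → (a + b) * c * d ≡ a * c * d + b * c * d
      distrib = solve-∀
    swap : ∀ a b c → a + (b + c) ≡ b + (a + c)
    swap = solve-∀

  -- Each summand: j + (n - j) = n produces the factor n.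
  summand : ∀ n j → j ≤ n →
    (n C j) * A (suc j) * B (n ∸ j) + (n C j) * A j * B (suc (n ∸ j))
    ≡ n * ((n C j) * A j * B (n ∸ j)) + (n C j) * A′ j * B (n ∸ j) + (n C j) * A j * B′ (n ∸ j)
  summand n j j≤n rewrite recA j | recB (n ∸ j) =
    leibniz (n C j) j (n ∸ j) (A j) (A′ j) (B (n ∸ j)) (B′ (n ∸ j)) n (m+[n∸m]≡n j≤n)
    where
    leibniz : ∀ b j m x a′ y b′ n → j + m ≡ n →
              b * (j * x + a′) * y + b * x * (m * y + b′) ≡ n * (b * x * y) + b * a′ * y + b * x * b′
    leibniz b j m x a′ y b′ n refl = ring b j m x a′ y b′
      where
      ring : ∀ b j m x a′ y b′ →
             b * (j * x + a′) * y + b * x * (m * y + b′) ≡ (j + m) * (b * x * y) + b * a′ * y + b * x * b′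
      ring = solve-∀

  conv-suc : ∀ n → conv A B (suc n) ≡ n * conv A B n + conv A′ B n + conv A B′ n
  conv-suc n = begin
    conv A B (suc n)
      ≡⟨ trans (pascal-split n) (sym (Σ≤-+ n _ _)) ⟩
    Σ≤ n (λ j → (n C j) * A (suc j) * B (n ∸ j) + (n C j) * A j * B (suc (n ∸ j)))
      ≡⟨ Σ≤-cong n (summand n) ⟩
    Σ≤ n (λ j → n * ((n C j) * A j * B (n ∸ j)) + (n C j) * A′ j * B (n ∸ j) + (n C j) * A j * B′ (n ∸ j))
      ≡⟨ trans (Σ≤-+ n _ _) (cong (_+ conv A B′ n) (Σ≤-+ n _ _)) ⟩
    Σ≤ n (λ j → n * ((n C j) * A j * B (n ∸ j))) + conv A′ B n + conv A B′ n
      ≡⟨ cong (λ z → z + conv A′ B n + conv A B′ n) (Σ≤-*ˡ n n _) ⟩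
    n * conv A B n + conv A′ B n + conv A B′ n ∎
    where open ≡-Reasoning

-- s(j+1, t) = j·s(j, t) + s(j, t-1), reading s(j, -1) as 0.
sPred : ℕ → ℕ → ℕ
sPred zero    j = 0
sPred (suc t) j = s j t

s-suc : ∀ t j → s (suc j) t ≡ j * s j t + sPred t j
s-suc zero    j = sym (trans (+-identityʳ _) (n*s[n,0]≡0 j))
s-suc (suc t) j = refl

-- The convolution Σ_j C(n,j) s(j,t) s(n-j,r): colour a subset of size j
-- with t cycles and its complement with r cycles.
stirlingConv : ℕ → ℕ → ℕ → ℕ
stirlingConv t r n = conv (λ j → s j t) (λ j → s j r) n

stirlingConv-suc : ∀ t r n → stirlingConv t r (suc n)
  ≡ n * stirlingConv t r n + conv (sPred t) (λ j → s j r) n + conv (λ j → s j t) (sPred r) n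
stirlingConv-suc t r = ConvolutionRecurrence.conv-suc (λ j → s j t) (sPred t) (λ j → s j r) (sPred r) (s-suc t) (s-suc r)

-- One step of the recurrence in n shared by t! r! stirlingConv t r n and
-- (t+r)! s(n, t+r), written for the slice X t r at fixed n:
-- X′ t r = n·X t r + t·X (t-1) r + r·X t (r-1).
lowerBy : ℕ → (ℕ → ℕ) → ℕ
lowerBy zero    f = 0
lowerBy (suc m) f = suc m * f m

step : ℕ → (ℕ → ℕ → ℕ) → ℕ → ℕ → ℕ
step n X t r = n * X t r + lowerBy t (λ t′ → X t′ r) + lowerBy r (λ r′ → X t r′)

step-cong : ∀ n {X Y : ℕ → ℕ → ℕ} → (∀ t r → X t r ≡ Y t r) → ∀ t r → step n X t r ≡ step n Y t r
step-cong n e t r = cong₂ _+_ (cong₂ _+_ (cong (n *_) (e t r)) (lowered t (λ t′ → e t′ r)))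
                              (lowered r (λ r′ → e t r′))
  where
  lowered : ∀ m {f g : ℕ → ℕ} → (∀ i → f i ≡ g i) → lowerBy m f ≡ lowerBy m g
  lowered zero    _ = refl
  lowered (suc m) e = cong (suc m *_) (e m)

weighted : ℕ → ℕ → ℕ → ℕ
weighted n t r = t ! * r ! * stirlingConv t r n

merged : ℕ → ℕ → ℕ → ℕ
merged n t r = (t + r) ! * s n (t + r)

weighted-suc : ∀ n t r → weighted (suc n) t r ≡ step n (weighted n) t r
weighted-suc n t r = begin
  t ! * r ! * stirlingConv t r (suc n)
    ≡⟨ cong (t ! * r ! *_) (stirlingConv-suc t r n) ⟩
  t ! * r ! * (n * stirlingConv t r n + conv (sPred t) (λ j → s j r) n + conv (λ j → s j t) (sPred r) n)
    ≡⟨ distrib (t ! * r !) n _ _ _ ⟩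
  n * weighted n t r + t ! * r ! * conv (sPred t) (λ j → s j r) n + t ! * r ! * conv (λ j → s j t) (sPred r) n
    ≡⟨ cong₂ (λ x y → n * weighted n t r + x + y) (lower-t t) (lower-r r) ⟩
  step n (weighted n) t r ∎
  where
  open ≡-Reasoning
  distrib : ∀ f n x y z → f * (n * x + y + z) ≡ n * (f * x) + f * y + f * z
  distrib = solve-∀
  no-cycles : ∀ B → conv (λ _ → 0) B n ≡ 0
  no-cycles B = Σ≤-zero n _ (λ j → cong (_* B (n ∸ j)) (*-zeroʳ (n C j)))
  lower-t : ∀ t → t ! * r ! * conv (sPred t) (λ j → s j r) n ≡ lowerBy t (λ t′ → weighted n t′ r)
  lower-t zero    = trans (cong (1 * r ! *_) (no-cycles (λ j → s j r))) (*-zeroʳ (1 * r !))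
  lower-t (suc m) = reassoc (suc m) (m !) (r !) (stirlingConv m r n)
    where
    reassoc : ∀ a f g x → a * f * g * x ≡ a * (f * g * x)
    reassoc = solve-∀
  lower-r : ∀ r → t ! * r ! * conv (λ j → s j t) (sPred r) n ≡ lowerBy r (λ r′ → weighted n t r′)
  lower-r zero    = trans (cong (t ! * 1 *_) (Σ≤-zero n _ (λ j → *-zeroʳ ((n C j) * s j t)))) (*-zeroʳ (t ! * 1))
  lower-r (suc m) = reassoc (t !) (suc m) (m !) (stirlingConv t m n)
    where
    reassoc : ∀ f a g x → f * (a * g) * x ≡ a * (f * g * x)
    reassoc = solve-∀

merged-suc : ∀ n t r → merged (suc n) t r ≡ step n (merged n) t r
merged-suc n t r = begin
  (t + r) ! * s (suc n) (t + r)
    ≡⟨ factorial-s-suc n (t + r) ⟩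
  n * merged n t r + (t + r) * Y
    ≡⟨ trans (cong (n * merged n t r +_) (*-distribʳ-+ Y t r)) (sym (+-assoc (n * merged n t r) _ _)) ⟩
  n * merged n t r + t * Y + r * Y
    ≡⟨ cong₂ (λ x y → n * merged n t r + x + y) (lower-t t) (lower-r r) ⟩
  step n (merged n) t r ∎
  where
  open ≡-Reasoning
  Y = (t + r ∸ 1) ! * s n (t + r ∸ 1)
  lower-t : ∀ t → t * ((t + r ∸ 1) ! * s n (t + r ∸ 1)) ≡ lowerBy t (λ t′ → merged n t′ r)
  lower-t zero    = refl
  lower-t (suc m) = refl
  lower-r : ∀ r → r * ((t + r ∸ 1) ! * s n (t + r ∸ 1)) ≡ lowerBy r (λ r′ → merged n t r′)
  lower-r zero    = refl
  lower-r (suc m) = cong (λ z → suc m * (z ! * s n z)) (cong (_∸ 1) (+-suc t m))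

stirlingConv-closed : ∀ n t r → weighted n t r ≡ merged n t r
stirlingConv-closed zero    zero    zero    = refl
stirlingConv-closed zero    zero    (suc r) = trans (*-zeroʳ (1 * suc r !)) (sym (*-zeroʳ (suc r !)))
stirlingConv-closed zero    (suc t) r       = trans (*-zeroʳ (suc t ! * r !)) (sym (*-zeroʳ ((suc t + r) !)))
stirlingConv-closed (suc n) t       r       =
  trans (weighted-suc n t r) (trans (step-cong n (stirlingConv-closed n) t r) (sym (merged-suc n t r)))

-- With a single colour, a colouring carries no information.

single-colouring : ∀ n (g : Vec (Fin 1) n → ℕ) → sumL (allVecs (allFin 1) n) g ≡ g (replicate n zero)
single-colouring zero    g = +-identityʳ _
single-colouring (suc n) g = trans (sumL-allVecs (allFin 1) n g) (trans (+-identityʳ _) (single-colouring n (λ v → g (zero ∷ v))))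

cycles-one-colour : ∀ {n} (σ : Vec (Fin n) n) (col : Vec (Fin 1) n) c → cyclesOfColour σ col c ≡ cycles σ
cycles-one-colour {n} σ col c =
  trans (length-filter (λ i → isCycleMin? σ i ×-dec (lookup col i F.≟ c)) (allFin n))
        (sym (trans (length-filter (isCycleMin? σ) (allFin n))
                    (sumL-cong (allFin n) (λ i → ind-cong (isCycleMin? σ i) _ (λ m → m , fin1-unique _ c) proj₁))))

stirling1-coloured : ∀ n m → stirling1 n m ≡ colouredPerms n 1 (λ _ → m)
stirling1-coloured n m = begin
  stirling1 n m
    ≡⟨ length-filter _ (allVecs (allFin n) n) ⟩
  sumL (allVecs (allFin n) n) (λ σ → ind (isPerm? σ ×-dec (cycles σ ≟ m)))
    ≡⟨ sumL-cong (allVecs (allFin n) n) (λ σ → ind-cong _ (hasProfile? (λ _ → m) (σ , replicate n zero))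
         (λ (p , e) → p , (λ i → fin1-unique _ _) , (λ c → trans (cycles-one-colour σ (replicate n zero) c) e))
         (λ (p , _ , h) → p , trans (sym (cycles-one-colour σ (replicate n zero) zero)) (h zero))) ⟩
  sumL (allVecs (allFin n) n) (λ σ → ind (hasProfile? (λ _ → m) (σ , replicate n zero)))
    ≡⟨ sumL-cong (allVecs (allFin n) n) (λ σ → single-colouring n (λ col → ind (hasProfile? (λ _ → m) (σ , col)))) ⟨
  sumL (allVecs (allFin n) n) (λ σ → sumL (allVecs (allFin 1) n) (λ col → ind (hasProfile? (λ _ → m) (σ , col))))
    ≡⟨ sumL-prod (allVecs (allFin n) n) (allVecs (allFin 1) n) _ ⟨
  colouredPerms n 1 (λ _ → m) ∎
  where open ≡-Reasoning

stirling1≡s : ∀ n m → stirling1 n m ≡ s n m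
stirling1≡s n m = *-cancelˡ-≡ (stirling1 n m) (s n m) (m !) {{m !≢0}} (begin
  m ! * stirling1 n m                   ≡⟨ cong (m ! *_) (stirling1-coloured n m) ⟩
  m ! * colouredPerms n 1 (λ _ → m)     ≡⟨ cong (_* colouredPerms n 1 (λ _ → m)) (*-identityʳ (m !)) ⟨
  m ! * 1 * colouredPerms n 1 (λ _ → m) ≡⟨ colouredPerms-closed n 1 (λ _ → m) ⟩
  (m + 0) ! * s n (m + 0)               ≡⟨ cong (λ z → z ! * s n z) (+-identityʳ m) ⟩
  m ! * s n m                           ∎)
  where open ≡-Reasoning

mixedProfile : ∀ k → ℕ → Fin (suc k) → ℕ
mixedProfile k t zero    = t
mixedProfile k t (suc c) = 1

mixedStirling-coloured : ∀ n k t → mixedStirling n (suc k) t ≡ colouredPerms n (suc k) (mixedProfile k t)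
mixedStirling-coloured n k t = trans (length-filter _ (allColoured n (suc k))) (sumL-cong (allColoured n (suc k)) same-condition)
  where
  same-condition : ∀ q → ind (isMixed? t (proj₁ q) (proj₂ q)) ≡ ind (hasProfile? (mixedProfile k t) q)
  same-condition (σ , col) = ind-cong (isMixed? t σ col) (hasProfile? (mixedProfile k t) (σ , col))
    (λ (p , cc , special , others) → p , cc , λ { zero → special ; (suc c) → others c })
    (λ (p , cc , h) → p , cc , h zero , λ c → h (suc c))

mixedStirling-closed : ∀ n k t → mixedStirling n (suc k) t ≡ k ! * stirlingConv t k n
mixedStirling-closed n k t = *-cancelˡ-≡ _ _ (t !) {{t !≢0}} (begin
  t ! * mixedStirling n (suc k) t
    ≡⟨ cong (t ! *_) (mixedStirling-coloured n k t) ⟩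
  t ! * M
    ≡⟨ cong (_* M) (trans (cong (t ! *_) (ones-product k)) (*-identityʳ (t !))) ⟨
  prodF (suc k) (λ c → mixedProfile k t c !) * M
    ≡⟨ colouredPerms-closed n (suc k) (mixedProfile k t) ⟩
  (t + sumF k (λ _ → 1)) ! * s n (t + sumF k (λ _ → 1))
    ≡⟨ cong (λ z → (t + z) ! * s n (t + z)) (trans (sumF-const k 1) (*-identityʳ k)) ⟩
  merged n t k
    ≡⟨ stirlingConv-closed n t k ⟨
  t ! * k ! * stirlingConv t k n
    ≡⟨ *-assoc (t !) (k !) _ ⟩
  t ! * (k ! * stirlingConv t k n) ∎)
  where
  open ≡-Reasoning
  M = colouredPerms n (suc k) (mixedProfile k t)
  ones-product : ∀ k → prodF k (λ _ → 1) ≡ 1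
  ones-product zero    = refl
  ones-product (suc k) = trans (+-identityʳ _) (ones-product k)

sumFromTo-step : ∀ a b f → a ≤ b → sumFromTo a b f ≡ f a + sumFromTo (suc a) b f
sumFromTo-step a b f a≤b rewrite +-∸-assoc 1 a≤b = refl

sumFromTo-empty : ∀ a b f → b < a → sumFromTo a b f ≡ 0
sumFromTo-empty a b f b<a rewrite m≤n⇒m∸n≡0 b<a = refl

sumFromTo-Σ≤ : ∀ d a f → sumFromTo a (a + d) f ≡ Σ≤ d (λ i → f (a + i))
sumFromTo-Σ≤ zero    a f = begin
  sumFromTo a (a + 0) f
    ≡⟨ sumFromTo-step a (a + 0) f (m≤m+n a 0) ⟩
  f a + sumFromTo (suc a) (a + 0) f
    ≡⟨ cong (f a +_) (sumFromTo-empty (suc a) (a + 0) f (s≤s (≤-reflexive (+-identityʳ a)))) ⟩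
  f a + 0
    ≡⟨ trans (+-identityʳ (f a)) (cong f (sym (+-identityʳ a))) ⟩
  f (a + 0) ∎
  where open ≡-Reasoning
sumFromTo-Σ≤ (suc d) a f = begin
  sumFromTo a (a + suc d) f                 ≡⟨ sumFromTo-step a (a + suc d) f (m≤m+n a (suc d)) ⟩
  f a + sumFromTo (suc a) (a + suc d) f     ≡⟨ cong (λ b → f a + sumFromTo (suc a) b f) (+-suc a d) ⟩
  f a + sumFromTo (suc a) (suc a + d) f     ≡⟨ cong (f a +_) (sumFromTo-Σ≤ d (suc a) f) ⟩
  f a + Σ≤ d (λ i → f (suc a + i))          ≡⟨ cong₂ _+_ (cong f (sym (+-identityʳ a)))
                                                         (Σ≤-cong d (λ i _ → cong f (sym (+-suc a i)))) ⟩
  f (a + 0) + Σ≤ d (λ i → f (a + suc i))    ∎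
  where open ≡-Reasoning

sumFromTo-from-zero : ∀ a b f → (∀ j → j < a → f j ≡ 0) → sumFromTo a b f ≡ sumFromTo 0 b f
sumFromTo-from-zero zero    b f _ = refl
sumFromTo-from-zero (suc a) b f below = trans skip (sumFromTo-from-zero a b f (λ j j<a → below j (m<n⇒m<1+n j<a)))
  where
  skip : sumFromTo (suc a) b f ≡ sumFromTo a b f
  skip with a ≤? b
  ... | yes a≤b = sym (trans (sumFromTo-step a b f a≤b) (cong (_+ sumFromTo (suc a) b f) (below a ≤-refl)))
  ... | no a≰b  = trans (sumFromTo-empty (suc a) b f (m<n⇒m<1+n (≰⇒> a≰b))) (sym (sumFromTo-empty a b f (≰⇒> a≰b)))

Σ≤-extend : ∀ d b f → (∀ j → b < j → j ≤ b + d → f j ≡ 0) → Σ≤ b f ≡ Σ≤ (b + d) f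
Σ≤-extend zero    b f _     = cong (λ n → Σ≤ n f) (sym (+-identityʳ b))
Σ≤-extend (suc d) b f above = begin
  Σ≤ b f
    ≡⟨ Σ≤-extend d b f (λ j b<j j≤ → above j b<j (widen j≤)) ⟩
  Σ≤ (b + d) f
    ≡⟨ +-identityʳ _ ⟨
  Σ≤ (b + d) f + 0
    ≡⟨ cong (Σ≤ (b + d) f +_) (above (suc (b + d)) (s≤s (m≤m+n b d)) (≤-reflexive (sym (+-suc b d)))) ⟨
  Σ≤ (b + d) f + f (suc (b + d))
    ≡⟨ Σ≤-last (b + d) f ⟨
  Σ≤ (suc (b + d)) f
    ≡⟨ cong (λ n → Σ≤ n f) (+-suc b d) ⟨
  Σ≤ (b + suc d) f ∎
  where
  open ≡-Reasoning
  widen : ∀ {j} → j ≤ b + d → j ≤ b + suc d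
  widen {j} j≤ = subst (j ≤_) (sym (+-suc b d)) (m≤n⇒m≤1+n j≤)

sumFromTo-window : ∀ a b n f → b ≤ n → (∀ j → j < a → f j ≡ 0) → (∀ j → b < j → j ≤ n → f j ≡ 0) →
                   sumFromTo a b f ≡ Σ≤ n f
sumFromTo-window a b n f b≤n below above = begin
  sumFromTo a b f          ≡⟨ sumFromTo-from-zero a b f below ⟩
  sumFromTo 0 b f          ≡⟨ sumFromTo-Σ≤ b 0 f ⟩
  Σ≤ b f                   ≡⟨ Σ≤-extend (n ∸ b) b f (λ j b<j j≤ → above j b<j (subst (j ≤_) n≡ j≤)) ⟩
  Σ≤ (b + (n ∸ b)) f       ≡⟨ cong (λ m → Σ≤ m f) n≡ ⟩
  Σ≤ n f                   ∎
  where
  open ≡-Reasoning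
  n≡ : b + (n ∸ b) ≡ n
  n≡ = m+[n∸m]≡n b≤n

upper-end : ∀ n k → suc k ≤ n → n ∸ suc k + 1 ≡ n ∸ k
upper-end n k k<n = trans (+-comm (n ∸ suc k) 1) (sym (+-∸-assoc 1 k<n))

∸-<-from-< : ∀ n j k → j ≤ n → n < j + k → n ∸ j < k
∸-<-from-< n       zero    k _         lt        = lt
∸-<-from-< (suc n) (suc j) k (s≤s j≤n) (s≤s lt) = ∸-<-from-< n j k j≤n lt

-- Beyond the upper end, fewer than k points remain for the k cycles.
beyond-upper-end : ∀ n k j → k ≤ n → n ∸ k < j → j ≤ n → n ∸ j < k
beyond-upper-end n k j k≤n lt j≤n = ∸-<-from-< n j k j≤n
  (subst (_< j + k) (m∸n+n≡m k≤n) (+-monoˡ-< k lt))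

summand : ℕ → ℕ → ℕ → ℕ → ℕ
summand n k t j = k ! * (n C j) * stirling1 j t * stirling1 (n ∸ j) k

summand-s : ∀ n k t j → k ! * ((n C j) * s j t * s (n ∸ j) k) ≡ summand n k t j
summand-s n k t j rewrite stirling1≡s j t | stirling1≡s (n ∸ j) k = reassoc (k !) (n C j) (s j t) (s (n ∸ j) k)
  where
  reassoc : ∀ a b c d → a * (b * c * d) ≡ a * b * c * d
  reassoc = solve-∀

mainTheorem7 : ∀ (n k t : ℕ) → 0 < k → 0 < t → k ≤ n → t ≤ n →
    mixedStirling n k t
      ≡ sumFromTo t (n ∸ k + 1)
          (λ j → (k ∸ 1) ! * (n C j) * stirling1 j t * stirling1 (n ∸ j) (k ∸ 1))
mainTheorem7 n (suc k) t _ _ k<n _ = begin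
  mixedStirling n (suc k) t                           ≡⟨ mixedStirling-closed n k t ⟩
  k ! * stirlingConv t k n                            ≡⟨ Σ≤-*ˡ n (k !) _ ⟨
  Σ≤ n (λ j → k ! * ((n C j) * s j t * s (n ∸ j) k))  ≡⟨ Σ≤-cong n (λ j _ → summand-s n k t j) ⟩
  Σ≤ n (summand n k t)                                ≡⟨ sumFromTo-window t _ n _ upper≤n below above ⟨
  sumFromTo t (n ∸ suc k + 1) (summand n k t)         ∎
  where
  open ≡-Reasoning
  upper≤n : n ∸ suc k + 1 ≤ n
  upper≤n = subst (_≤ n) (sym (upper-end n k k<n)) (m∸n≤m n k)
  -- fewer than t points cannot form t cycles
  below : ∀ j → j < t → summand n k t j ≡ 0
  below j j<t rewrite stirling1≡s j t | s-below j t j<t = cong (_* stirling1 (n ∸ j) k) (*-zeroʳ (k ! * (n C j)))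
  above : ∀ j → n ∸ suc k + 1 < j → j ≤ n → summand n k t j ≡ 0
  above j lt j≤n rewrite stirling1≡s (n ∸ j) k
                       | s-below (n ∸ j) k (beyond-upper-end n k j (<⇒≤ k<n) (subst (_< j) (upper-end n k k<n) lt) j≤n)
    = *-zeroʳ (k ! * (n C j) * stirling1 j t)
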